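{- Let $x,y$ be positive integers and $m,n\in\mathbb{N}$. Let $\boldsymbol{Z}=\{z_{i,j}=(x_{i,j},y_{i,j}): (i,j)\preceq(m,n)\}$ with $x_{i,j},y_{i,j}\in\mathbb{N}$, $0\le x_{i,j}<x$, $0\le y_{i,j}<y$, and $x_{i,j}\le x_{i',j'}$, $y_{i,j}\le y_{i',j'}$ whenever $(i',j')\preceq(i,j)\preceq(m,n)$. Define $\boldsymbol{U}=\{(u_{i,j},v_{i,j})\}$ by $u_{i,j}=x-x_{i,j}$, $v_{i,j}=y-y_{i,j}$, and $-\boldsymbol{U}=\{(-u_{i,j},-v_{i,j})\}$. Then $$\Big|\bigcup_{P:O\to A}\mathcal{I}_{m,n}(P;\boldsymbol{U})\Big|=\frac{1}{m!\,n!}\,\tilde g_{m,n}((0,0);-\boldsymbol{U}),$$ where $P$ ranges over all lattice paths from $O=(0,0)$ to $A=(m,n)$ with steps $(1,0)$ and $(0,1)$.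
   Context: Bivariate difference Gončarov polynomials (over $\mathbb{Q}$): for $p\in\mathbb{Q}[X,Y]$ let $\Delta_X p(X,Y)=p(X,Y)-p(X-1,Y)$, $\Delta_Y p(X,Y)=p(X,Y)-p(X,Y-1)$; $(i,j)\preceq(m,n)$ means $i\le m$, $j\le n$; for a node set $\boldsymbol{W}=\{w_{i,j}\}$, $\tilde g_{m,n}((X,Y);\boldsymbol{W})$ is the unique polynomial of degree at most $m$ in $X$ and at most $n$ in $Y$ such that $\Delta_X^i\Delta_Y^j\tilde g_{m,n}$ evaluated at $w_{i,j}$ equals $m!\,n!\,\delta_{m,i}\delta_{n,j}$ for all $(i,j)\preceq(m,n)$. $\mathcal{I}(m,n)$ is the set of pairs $(\boldsymbol{a},\boldsymbol{b})$ of integer sequences with $0\le a_0\le\cdots\le a_{m-1}<x$ and $0\le b_0\le\cdots\le b_{n-1}<y$. For a lattice path $P=e_1\cdots e_{m+n}$ from $(0,0)$ to $(m,n)$ with steps $E=(1,0)$, $N=(0,1)$, a pair $(\boldsymbol{a},\boldsymbol{b})$ is bounded by $P$ with respect to $\boldsymbol{U}$ if for every $r$: if $e_r$ is an $E$-step from $(i,j)$ then $a_i<u_{i,j}$, and if $e_r$ is an $N$-step from $(i,j)$ then $b_j<v_{i,j}$. $\mathcal{I}_{m,n}(P;\boldsymbol{U})$ is the set of pairs in $\mathcal{I}(m,n)$ bounded by $P$ with respect to $\boldsymbol{U}$. -}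

module Defs where

open import Data.Nat as ℕ using (ℕ; zero; suc; _≤_; _<_; _∸_; _!; _<ᵇ_; _≡ᵇ_)
open import Data.Integer as ℤ using (ℤ; +_; -[1+_])
open import Data.Rational as ℚ using (ℚ; 0ℚ; 1ℚ; _+_; _*_; _-_; -_; _/_)
open import Data.Bool using (Bool; true; false; _∧_; _∨_; if_then_else_)
open import Data.List as L using (List; []; _∷_; map; _++_; length; cartesianProduct; filterᵇ)
open import Data.Bool.ListAction using (any)
open import Data.Vec as V using (Vec; []; _∷_)
open import Data.Fin using (Fin; toℕ; zero; suc)
open import Data.Product using (_×_; _,_; proj₁; proj₂)
open import Relation.Binary.PropositionalEquality using (_≡_)

ℕtoℚ : ℕ → ℚ
ℕtoℚ k = (+ k) / 1

-- Bivariate polynomials over ℚ of degree ≤ m in X and ≤ n in Y,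
-- given by their coefficient array c k l  (coefficient of X^k Y^l).

Poly : ℕ → ℕ → Set
Poly m n = Fin (suc m) → Fin (suc n) → ℚ

powℚ : ℚ → ℕ → ℚ
powℚ q zero    = 1ℚ
powℚ q (suc k) = q * powℚ q k

sumFin : (k : ℕ) → (Fin k → ℚ) → ℚ
sumFin zero    f = 0ℚ
sumFin (suc k) f = f zero + sumFin k (λ i → f (suc i))

eval : ∀ {m n} → Poly m n → ℚ → ℚ → ℚ
eval {m} {n} c X Y =
  sumFin (suc m) λ k → sumFin (suc n) λ l → c k l * (powℚ X (toℕ k) * powℚ Y (toℕ l))

-- Backward difference operators on functions ℚ × ℚ → ℚ
-- (applied to the polynomial function of p; over ℚ this is the same as
-- applying them to the polynomial itself).

ΔX : (ℚ → ℚ → ℚ) → (ℚ → ℚ → ℚ)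
ΔX f X Y = f X Y - f (X - 1ℚ) Y

ΔY : (ℚ → ℚ → ℚ) → (ℚ → ℚ → ℚ)
ΔY f X Y = f X Y - f X (Y - 1ℚ)

iter : {A : Set} → ℕ → (A → A) → A → A
iter zero    g a = a
iter (suc k) g a = g (iter k g a)

ΔXY : ℕ → ℕ → (ℚ → ℚ → ℚ) → (ℚ → ℚ → ℚ)
ΔXY i j f = iter i ΔX (iter j ΔY f)

target : ℕ → ℕ → ℕ → ℕ → ℚ
target m n i j = if (i ≡ᵇ m) ∧ (j ≡ᵇ n) then ℕtoℚ (m ! ℕ.* n !) else 0ℚ

-- p is the bivariate difference Gončarov polynomial g̃_{m,n}(·; W),
-- W given by coordinate functions wX, wY : ℕ → ℕ → ℚ (w_{i,j} = (wX i j, wY i j)).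
IsDiffGoncarov : (m n : ℕ) → (wX wY : ℕ → ℕ → ℚ) → Poly m n → Set
IsDiffGoncarov m n wX wY p =
  ∀ i j → i ≤ m → j ≤ n →
    ΔXY i j (eval p) (wX i j) (wY i j) ≡ target m n i j

seqs : ℕ → ℕ → List (List ℕ)
seqs b zero    = [] ∷ []
seqs b (suc k) = L.concatMap (λ v → map (v ∷_) (seqs b k)) (L.upTo b)

nondecr : List ℕ → Bool
nondecr []            = true
nondecr (a ∷ [])      = true
nondecr (a ∷ b ∷ as)  = (a ℕ.≤ᵇ b) ∧ nondecr (b ∷ as)

Iset : (x y m n : ℕ) → List (List ℕ × List ℕ)
Iset x y m n =
  filterᵇ (λ ab → nondecr (proj₁ ab) ∧ nondecr (proj₂ ab))
          (cartesianProduct (seqs x m) (seqs y n))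

data Step : Set where
  E N : Step

paths : ℕ → ℕ → List (List Step)
paths zero    zero    = [] ∷ []
paths (suc m) zero    = map (E ∷_) (paths m zero)
paths zero    (suc n) = map (N ∷_) (paths zero n)
paths (suc m) (suc n) = map (E ∷_) (paths m (suc n)) ++ map (N ∷_) (paths (suc m) n)

-- k-th entry of a list (0-indexed; only used for in-range indices)
at : List ℕ → ℕ → ℕ
at []       k       = 0
at (a ∷ as) zero    = a
at (a ∷ as) (suc k) = at as k

-- (a,b) bounded by the path (steps es, currently at (i,j)) w.r.t. U = (u,v):
-- an E-step from (i,j) requires a_i < u_{i,j}, an N-step from (i,j) requires b_j < v_{i,j}.
boundedFrom : (u v : ℕ → ℕ → ℕ) → List ℕ → List ℕ → ℕ → ℕ → List Step → Bool
boundedFrom u v a b i j []       = true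
boundedFrom u v a b i j (E ∷ es) = (at a i <ᵇ u i j) ∧ boundedFrom u v a b (suc i) j es
boundedFrom u v a b i j (N ∷ es) = (at b j <ᵇ v i j) ∧ boundedFrom u v a b i (suc j) es

bounded : (u v : ℕ → ℕ → ℕ) → List Step → List ℕ × List ℕ → Bool
bounded u v P (a , b) = boundedFrom u v a b 0 0 P

unionCount : (x y m n : ℕ) → (u v : ℕ → ℕ → ℕ) → ℕ
unionCount x y m n u v =
  length (filterᵇ (λ ab → any (λ P → bounded u v P ab) (paths m n)) (Iset x y m n))

module Submission where

-- Write A i j s t for Δ_X^i Δ_Y^j g(−s, −t), and N i j s t for the number of pairs of weakly
-- increasing sequences of lengths m − i and n − j with entries below x − s and y − t that are
-- bounded by some path from (i, j) to (m, n) w.r.t. the nodes lowered by (s, t).  Splitting on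
-- whether the first entry of a is 0 gives N i j s t = N i j (s+1) t + N (i+1) j s t: a leading 0
-- lets the path start with an E-step, otherwise one subtracts 1 from all entries of a.  Since
-- F(−s) = F(−s−1) + (Δ F)(−s), the differences A satisfy the same recurrence (and its mirror in
-- the second coordinate), the terms of order m + 1 or n + 1 vanishing by degree.  The Gončarov
-- conditions say that A and m! n! N agree at every node (u i j, v i j), and the recurrence
-- transports this agreement down to the origin A 0 0 0 0 = g(0, 0).  Existence of g comes from the
-- Newton basis X (X + 1) ⋯ (X + k − 1) / k!, whose differences at 0 can be prescribed freely.

open import Defs
open import Data.Nat using (ℕ; suc; _≤_; _<_)

module ℕtoℚ-Properties where

  open import Data.Nat as ℕ using (ℕ; suc)
  open import Data.Integer as ℤ using (+_)
  import Data.Integer.Properties as ℤP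
  import Data.Integer.Solver as ℤSolver
  open import Data.Rational using (ℚ; 1ℚ; _+_; _*_; _-_; -_; _/_; toℚᵘ)
  import Data.Rational.Properties as ℚP
  import Data.Rational.Unnormalised as ℚᵘ
  import Data.Rational.Unnormalised.Properties as ℚᵘP
  import Data.Rational.Solver as ℚSolver
  open import Relation.Binary.PropositionalEquality

  private
    toℚᵘ-ℕtoℚ : ∀ k → toℚᵘ (ℕtoℚ k) ℚᵘ.≃ ℚᵘ.mkℚᵘ (+ k) 0
    toℚᵘ-ℕtoℚ k = ℚP.toℚᵘ-fromℚᵘ (ℚᵘ.mkℚᵘ (+ k) 0)

  ℕtoℚ-+ : ∀ a b → ℕtoℚ (a ℕ.+ b) ≡ ℕtoℚ a + ℕtoℚ b
  ℕtoℚ-+ a b = ℚP.toℚᵘ-injective (begin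
      toℚᵘ (ℕtoℚ (a ℕ.+ b))                 ≈⟨ toℚᵘ-ℕtoℚ (a ℕ.+ b) ⟩
      ℚᵘ.mkℚᵘ (+ (a ℕ.+ b)) 0                ≈⟨ ℚᵘ.*≡* integral ⟩
      ℚᵘ.mkℚᵘ (+ a) 0 ℚᵘ.+ ℚᵘ.mkℚᵘ (+ b) 0   ≈⟨ ℚᵘP.+-cong (toℚᵘ-ℕtoℚ a) (toℚᵘ-ℕtoℚ b) ⟨
      toℚᵘ (ℕtoℚ a) ℚᵘ.+ toℚᵘ (ℕtoℚ b)       ≈⟨ ℚP.toℚᵘ-homo-+ (ℕtoℚ a) (ℕtoℚ b) ⟨
      toℚᵘ (ℕtoℚ a + ℕtoℚ b)                 ∎)
    where
    open ℚᵘP.≃-Reasoning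
    open ℤSolver.+-*-Solver
    integral : + (a ℕ.+ b) ℤ.* + 1 ≡ (+ a ℤ.* + 1 ℤ.+ + b ℤ.* + 1) ℤ.* + 1
    integral = trans (cong (ℤ._* + 1) (ℤP.pos-+ a b))
      (solve 2 (λ a b → (a :+ b) :* con (+ 1) := (a :* con (+ 1) :+ b :* con (+ 1)) :* con (+ 1)) refl (+ a) (+ b))

  ℕtoℚ-suc : ∀ k → ℕtoℚ (suc k) ≡ 1ℚ + ℕtoℚ k
  ℕtoℚ-suc = ℕtoℚ-+ 1

  -ℕtoℚ-suc : ∀ k → - ℕtoℚ (suc k) ≡ - ℕtoℚ k - 1ℚ
  -ℕtoℚ-suc k = trans (cong -_ (ℕtoℚ-suc k))
                      (solve 1 (λ a → :- (con 1ℚ :+ a) := :- a :- con 1ℚ) refl (ℕtoℚ k))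
    where open ℚSolver.+-*-Solver

  1/suc : ℕ → ℚ
  1/suc k = + 1 / suc k

  1/suc-inverseˡ : ∀ k → 1/suc k * ℕtoℚ (suc k) ≡ 1ℚ
  1/suc-inverseˡ k = ℚP.toℚᵘ-injective (begin
      toℚᵘ (1/suc k * ℕtoℚ (suc k))
        ≈⟨ ℚP.toℚᵘ-homo-* (1/suc k) (ℕtoℚ (suc k)) ⟩
      toℚᵘ (1/suc k) ℚᵘ.* toℚᵘ (ℕtoℚ (suc k))
        ≈⟨ ℚᵘP.*-cong (ℚP.toℚᵘ-fromℚᵘ (ℚᵘ.mkℚᵘ (+ 1) k)) (toℚᵘ-ℕtoℚ (suc k)) ⟩
      ℚᵘ.mkℚᵘ (+ 1) k ℚᵘ.* ℚᵘ.mkℚᵘ (+ suc k) 0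
        ≈⟨ ℚᵘ.*≡* (solve 1 (λ n → (con (+ 1) :* n) :* con (+ 1) := con (+ 1) :* (n :* con (+ 1))) refl (+ suc k)) ⟩
      toℚᵘ 1ℚ ∎)
    where
    open ℚᵘP.≃-Reasoning
    open ℤSolver.+-*-Solver

module FinSum where

  open import Data.Nat using (zero; suc)
  open import Data.Fin using (Fin; zero; suc)
  open import Data.Rational using (ℚ; 0ℚ; _+_; _*_; _-_)
  import Data.Rational.Properties as ℚP
  open import Data.Rational.Solver
  open import Relation.Binary.PropositionalEquality
  open +-*-Solver

  sumFin-cong : ∀ k {f g : Fin k → ℚ} → (∀ a → f a ≡ g a) → sumFin k f ≡ sumFin k g
  sumFin-cong zero    eq = refl
  sumFin-cong (suc k) eq = cong₂ _+_ (eq zero) (sumFin-cong k (λ a → eq (suc a)))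

  sumFin-zero : ∀ k {f : Fin k → ℚ} → (∀ a → f a ≡ 0ℚ) → sumFin k f ≡ 0ℚ
  sumFin-zero zero    eq = refl
  sumFin-zero (suc k) eq = cong₂ _+_ (eq zero) (sumFin-zero k (λ a → eq (suc a)))

  sumFin-+ : ∀ k (f g : Fin k → ℚ) → sumFin k (λ a → f a + g a) ≡ sumFin k f + sumFin k g
  sumFin-+ zero    f g = refl
  sumFin-+ (suc k) f g =
    trans (cong (f zero + g zero +_) (sumFin-+ k (λ a → f (suc a)) (λ a → g (suc a))))
          (solve 4 (λ a b c d → (a :+ c) :+ (b :+ d) := (a :+ b) :+ (c :+ d)) refl
                 (f zero) (sumFin k (λ a → f (suc a))) (g zero) (sumFin k (λ a → g (suc a))))

  sumFin-- : ∀ k (f g : Fin k → ℚ) → sumFin k (λ a → f a - g a) ≡ sumFin k f - sumFin k g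
  sumFin-- zero    f g = refl
  sumFin-- (suc k) f g =
    trans (cong (f zero - g zero +_) (sumFin-- k (λ a → f (suc a)) (λ a → g (suc a))))
          (solve 4 (λ a b c d → (a :- c) :+ (b :- d) := (a :+ b) :- (c :+ d)) refl
                 (f zero) (sumFin k (λ a → f (suc a))) (g zero) (sumFin k (λ a → g (suc a))))

  sumFin-*ˡ : ∀ k (f : Fin k → ℚ) c → c * sumFin k f ≡ sumFin k (λ a → c * f a)
  sumFin-*ˡ zero    f c = ℚP.*-zeroʳ c
  sumFin-*ˡ (suc k) f c = trans (ℚP.*-distribˡ-+ c (f zero) (sumFin k (λ a → f (suc a))))
                                (cong (c * f zero +_) (sumFin-*ˡ k (λ a → f (suc a)) c))

  sumFin-*ʳ : ∀ k (f : Fin k → ℚ) c → sumFin k f * c ≡ sumFin k (λ a → f a * c)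
  sumFin-*ʳ zero    f c = ℚP.*-zeroˡ c
  sumFin-*ʳ (suc k) f c = trans (ℚP.*-distribʳ-+ c (f zero) (sumFin k (λ a → f (suc a))))
                                (cong (f zero * c +_) (sumFin-*ʳ k (λ a → f (suc a)) c))

  sumFin-swap : ∀ k l (f : Fin k → Fin l → ℚ) →
                sumFin k (λ a → sumFin l (f a)) ≡ sumFin l (λ b → sumFin k (λ a → f a b))
  sumFin-swap zero    l f = sym (sumFin-zero l (λ _ → refl))
  sumFin-swap (suc k) l f =
    trans (cong (sumFin l (f zero) +_) (sumFin-swap k l (λ a → f (suc a))))
          (sym (sumFin-+ l (f zero) (λ b → sumFin k (λ a → f (suc a) b))))

module Differences where

  open import Data.Nat using (ℕ; zero; suc; _≤_; ≤′-refl; ≤′-step)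
  import Data.Nat.Properties as ℕP
  open import Data.Fin using (Fin; toℕ)
  open import Data.Fin.Properties using (toℕ≤pred[n])
  open import Data.Rational using (ℚ; 0ℚ; 1ℚ; _+_; _*_; _-_)
  open import Data.Rational.Solver
  open import Relation.Binary.PropositionalEquality
  open +-*-Solver
  open ℕtoℚ-Properties
  open FinSum

  Δ : (ℚ → ℚ) → ℚ → ℚ
  Δ h X = h X - h (X - 1ℚ)

  iterΔ-cong : ∀ {f g : ℚ → ℚ} → (∀ X → f X ≡ g X) → ∀ i X → iter i Δ f X ≡ iter i Δ g X
  iterΔ-cong eq zero    X = eq X
  iterΔ-cong eq (suc i) X = cong₂ _-_ (iterΔ-cong eq i X) (iterΔ-cong eq i (X - 1ℚ))

  iterΔX-cong : ∀ {F G : ℚ → ℚ → ℚ} → (∀ X Y → F X Y ≡ G X Y) →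
                ∀ i X Y → iter i ΔX F X Y ≡ iter i ΔX G X Y
  iterΔX-cong eq zero    X Y = eq X Y
  iterΔX-cong eq (suc i) X Y = cong₂ _-_ (iterΔX-cong eq i X Y) (iterΔX-cong eq i (X - 1ℚ) Y)

  iterΔY-cong : ∀ {F G : ℚ → ℚ → ℚ} → (∀ X Y → F X Y ≡ G X Y) →
                ∀ j X Y → iter j ΔY F X Y ≡ iter j ΔY G X Y
  iterΔY-cong eq zero    X Y = eq X Y
  iterΔY-cong eq (suc j) X Y = cong₂ _-_ (iterΔY-cong eq j X Y) (iterΔY-cong eq j X (Y - 1ℚ))

  iterΔX-sumFin : ∀ i k (F : Fin k → ℚ → ℚ → ℚ) X Y →
    iter i ΔX (λ X Y → sumFin k (λ a → F a X Y)) X Y ≡ sumFin k (λ a → iter i ΔX (F a) X Y)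
  iterΔX-sumFin zero    k F X Y = refl
  iterΔX-sumFin (suc i) k F X Y =
    trans (cong₂ _-_ (iterΔX-sumFin i k F X Y) (iterΔX-sumFin i k F (X - 1ℚ) Y))
          (sym (sumFin-- k (λ a → iter i ΔX (F a) X Y) (λ a → iter i ΔX (F a) (X - 1ℚ) Y)))

  iterΔY-sumFin : ∀ j k (F : Fin k → ℚ → ℚ → ℚ) X Y →
    iter j ΔY (λ X Y → sumFin k (λ a → F a X Y)) X Y ≡ sumFin k (λ a → iter j ΔY (F a) X Y)
  iterΔY-sumFin zero    k F X Y = refl
  iterΔY-sumFin (suc j) k F X Y =
    trans (cong₂ _-_ (iterΔY-sumFin j k F X Y) (iterΔY-sumFin j k F X (Y - 1ℚ)))
          (sym (sumFin-- k (λ a → iter j ΔY (F a) X Y) (λ a → iter j ΔY (F a) X (Y - 1ℚ))))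

  iterΔX-separable : ∀ i c (A B : ℚ → ℚ) X Y →
    iter i ΔX (λ X Y → c * (A X * B Y)) X Y ≡ c * (iter i Δ A X * B Y)
  iterΔX-separable zero    c A B X Y = refl
  iterΔX-separable (suc i) c A B X Y =
    trans (cong₂ _-_ (iterΔX-separable i c A B X Y) (iterΔX-separable i c A B (X - 1ℚ) Y))
          (solve 4 (λ c a a′ b → c :* (a :* b) :- c :* (a′ :* b) := c :* ((a :- a′) :* b)) refl
                 c (iter i Δ A X) (iter i Δ A (X - 1ℚ)) (B Y))

  iterΔY-separable : ∀ j c (A B : ℚ → ℚ) X Y →
    iter j ΔY (λ X Y → c * (A X * B Y)) X Y ≡ c * (A X * iter j Δ B Y)
  iterΔY-separable zero    c A B X Y = refl
  iterΔY-separable (suc j) c A B X Y =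
    trans (cong₂ _-_ (iterΔY-separable j c A B X Y) (iterΔY-separable j c A B X (Y - 1ℚ)))
          (solve 4 (λ c a b b′ → c :* (a :* b) :- c :* (a :* b′) := c :* (a :* (b :- b′))) refl
                 c (A X) (iter j Δ B Y) (iter j Δ B (Y - 1ℚ)))

  separableSum : (K L : ℕ) → (Fin K → Fin L → ℚ) → (Fin K → ℚ → ℚ) → (Fin L → ℚ → ℚ) →
                 ℚ → ℚ → ℚ
  separableSum K L c A B X Y = sumFin K λ k → sumFin L λ l → c k l * (A k X * B l Y)

  ΔXY-separableSum : ∀ i j K L c A B X Y →
    ΔXY i j (separableSum K L c A B) X Y
      ≡ separableSum K L c (λ k → iter i Δ (A k)) (λ l → iter j Δ (B l)) X Y
  ΔXY-separableSum i j K L c A B X Y =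
    trans (iterΔX-cong ΔY-part i X Y)
    (trans (iterΔX-sumFin i K _ X Y)
    (sumFin-cong K (λ k → trans (iterΔX-sumFin i L _ X Y)
      (sumFin-cong L (λ l → iterΔX-separable i (c k l) (A k) (iter j Δ (B l)) X Y)))))
    where
    ΔY-part : ∀ X Y → iter j ΔY (separableSum K L c A B) X Y
                        ≡ separableSum K L c A (λ l → iter j Δ (B l)) X Y
    ΔY-part X Y = trans (iterΔY-sumFin j K _ X Y)
      (sumFin-cong K (λ k → trans (iterΔY-sumFin j L _ X Y)
        (sumFin-cong L (λ l → iterΔY-separable j (c k l) (A k) (B l) X Y))))

  iterΔX-ΔY-comm : ∀ i (F : ℚ → ℚ → ℚ) X Y → iter i ΔX (ΔY F) X Y ≡ ΔY (iter i ΔX F) X Y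
  iterΔX-ΔY-comm zero    F X Y = refl
  iterΔX-ΔY-comm (suc i) F X Y =
    trans (cong₂ _-_ (iterΔX-ΔY-comm i F X Y) (iterΔX-ΔY-comm i F (X - 1ℚ) Y))
          (solve 4 (λ a b c d → (a :- b) :- (c :- d) := (a :- c) :- (b :- d)) refl
                 (G X Y) (G X (Y - 1ℚ)) (G (X - 1ℚ) Y) (G (X - 1ℚ) (Y - 1ℚ)))
    where G = iter i ΔX F

  ΔXY-unfoldY : ∀ i j F X Y → ΔXY i (suc j) F X Y ≡ ΔXY i j F X Y - ΔXY i j F X (Y - 1ℚ)
  ΔXY-unfoldY i j F = iterΔX-ΔY-comm i (iter j ΔY F)

  Degree≤ : ℕ → (ℚ → ℚ) → Set
  Degree≤ r h = ∀ X → iter (suc r) Δ h X ≡ 0ℚ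

  Degree≤-suc : ∀ r h → Degree≤ r h → Degree≤ (suc r) h
  Degree≤-suc r h D X = cong₂ _-_ (D X) (D (X - 1ℚ))

  Degree≤-mono : ∀ k r h → k ≤ r → Degree≤ k h → Degree≤ r h
  Degree≤-mono k r h k≤r D with ℕP.≤⇒≤′ k≤r
  ... | ≤′-refl        = D
  ... | ≤′-step {r′} p = Degree≤-suc r′ h (Degree≤-mono k r′ h (ℕP.≤′⇒≤ p) D)

  iterΔ-mulX : ∀ (h : ℚ → ℚ) r X →
    iter (suc r) Δ (λ Z → Z * h Z) X ≡ X * iter (suc r) Δ h X + ℕtoℚ (suc r) * iter r Δ h (X - 1ℚ)
  iterΔ-mulX h zero X =
    solve 3 (λ x a b → x :* a :- (x :- con 1ℚ) :* b := x :* (a :- b) :+ con 1ℚ :* b) refl X (h X) (h (X - 1ℚ))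
  iterΔ-mulX h (suc r) X = begin
    iter (suc r) Δ (λ Z → Z * h Z) X - iter (suc r) Δ (λ Z → Z * h Z) (X - 1ℚ)
      ≡⟨ cong₂ _-_ (iterΔ-mulX h r X) (iterΔ-mulX h r (X - 1ℚ)) ⟩
    (X * A X + c * B (X - 1ℚ)) - ((X - 1ℚ) * A (X - 1ℚ) + c * B ((X - 1ℚ) - 1ℚ))
      ≡⟨ solve 5 (λ x ax b₁ b₂ c → (x :* ax :+ c :* b₁) :- ((x :- con 1ℚ) :* (b₁ :- b₂) :+ c :* b₂)
                   := x :* (ax :- (b₁ :- b₂)) :+ (con 1ℚ :+ c) :* (b₁ :- b₂)) refl
               X (A X) (B (X - 1ℚ)) (B ((X - 1ℚ) - 1ℚ)) c ⟩
    X * (A X - A (X - 1ℚ)) + (1ℚ + c) * A (X - 1ℚ)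
      ≡⟨ cong (λ z → X * (A X - A (X - 1ℚ)) + z * A (X - 1ℚ)) (sym (ℕtoℚ-suc (suc r))) ⟩
    X * iter (suc (suc r)) Δ h X + ℕtoℚ (suc (suc r)) * iter (suc r) Δ h (X - 1ℚ) ∎
    where
    open ≡-Reasoning
    A = iter (suc r) Δ h
    B = iter r Δ h
    c = ℕtoℚ (suc r)

  Degree≤-mulX : ∀ r h → Degree≤ r h → Degree≤ (suc r) (λ Z → Z * h Z)
  Degree≤-mulX r h D X = begin
    iter (suc (suc r)) Δ (λ Z → Z * h Z) X
      ≡⟨ iterΔ-mulX h (suc r) X ⟩
    X * iter (suc (suc r)) Δ h X + ℕtoℚ (suc (suc r)) * iter (suc r) Δ h (X - 1ℚ)
      ≡⟨ cong₂ (λ a b → X * a + ℕtoℚ (suc (suc r)) * b) (Degree≤-suc r h D X) (D (X - 1ℚ)) ⟩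
    X * 0ℚ + ℕtoℚ (suc (suc r)) * 0ℚ
      ≡⟨ solve 2 (λ x c → x :* con 0ℚ :+ c :* con 0ℚ := con 0ℚ) refl X (ℕtoℚ (suc (suc r))) ⟩
    0ℚ ∎
    where open ≡-Reasoning

  Degree≤-pow : ∀ k → Degree≤ k (λ X → powℚ X k)
  Degree≤-pow zero    X = refl
  Degree≤-pow (suc k) = Degree≤-mulX k (λ X → powℚ X k) (Degree≤-pow k)

  Degree≤-monomial : ∀ {m} (k : Fin (suc m)) → Degree≤ m (λ X → powℚ X (toℕ k))
  Degree≤-monomial {m} k = Degree≤-mono (toℕ k) m _ (toℕ≤pred[n] k) (Degree≤-pow (toℕ k))

  monomials : (d : ℕ) → Fin d → ℚ → ℚ
  monomials d k X = powℚ X (toℕ k)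

  ΔXY-eval-vanishˣ : ∀ {m n} (p : Poly m n) j X Y → ΔXY (suc m) j (eval p) X Y ≡ 0ℚ
  ΔXY-eval-vanishˣ {m} {n} p j X Y =
    trans (ΔXY-separableSum (suc m) j (suc m) (suc n) p (monomials (suc m)) (monomials (suc n)) X Y)
          (sumFin-zero (suc m) (λ k → sumFin-zero (suc n) (λ l →
            let B = iter j Δ (λ Y → powℚ Y (toℕ l)) Y in
            trans (cong (λ z → p k l * (z * B)) (Degree≤-monomial k X))
                  (solve 2 (λ a b → a :* (con 0ℚ :* b) := con 0ℚ) refl (p k l) B))))

  ΔXY-eval-vanishʸ : ∀ {m n} (p : Poly m n) i X Y → ΔXY i (suc n) (eval p) X Y ≡ 0ℚ
  ΔXY-eval-vanishʸ {m} {n} p i X Y =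
    trans (ΔXY-separableSum i (suc n) (suc m) (suc n) p (monomials (suc m)) (monomials (suc n)) X Y)
          (sumFin-zero (suc m) (λ k → sumFin-zero (suc n) (λ l →
            let A = iter i Δ (λ X → powℚ X (toℕ k)) X in
            trans (cong (λ z → p k l * (A * z)) (Degree≤-monomial l Y))
                  (solve 2 (λ a b → a :* (b :* con 0ℚ) := con 0ℚ) refl (p k l) A))))

module NewtonBasis where

  open import Data.Nat as ℕ using (ℕ; zero; suc; _<_; _∸_; s≤s; _≡ᵇ_)
  import Data.Nat.Properties as ℕP
  open import Data.Fin using (toℕ; zero; suc)
  open import Data.Bool using (if_then_else_)
  open import Data.Rational using (ℚ; 0ℚ; 1ℚ; _+_; _*_; _-_)
  import Data.Rational.Properties as ℚP
  open import Data.Rational.Solver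
  open import Relation.Binary.PropositionalEquality
  open import Relation.Nullary using (yes; no)
  open +-*-Solver
  open ℕtoℚ-Properties
  open FinSum
  open Differences

  newtonBasis : ℕ → ℚ → ℚ
  newtonBasis zero    X = 1ℚ
  newtonBasis (suc k) X = newtonBasis k X * (X + ℕtoℚ k) * 1/suc k

  newtonBasis-shift : ∀ k X → newtonBasis (suc k) (X - 1ℚ) ≡ (X - 1ℚ) * 1/suc k * newtonBasis k X
  newtonBasis-shift zero X =
    solve 1 (λ x → con 1ℚ :* (x :+ con 0ℚ) :* con 1ℚ := x :* con 1ℚ :* con 1ℚ) refl (X - 1ℚ)
  newtonBasis-shift (suc k) X = begin
    newtonBasis (suc k) (X - 1ℚ) * ((X - 1ℚ) + ℕtoℚ (suc k)) * 1/suc (suc k)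
      ≡⟨ cong₂ (λ a b → a * ((X - 1ℚ) + b) * 1/suc (suc k)) (newtonBasis-shift k X) (ℕtoℚ-suc k) ⟩
    (X - 1ℚ) * 1/suc k * newtonBasis k X * ((X - 1ℚ) + (1ℚ + ℕtoℚ k)) * 1/suc (suc k)
      ≡⟨ solve 5 (λ x i b n j → (x :- con 1ℚ) :* i :* b :* ((x :- con 1ℚ) :+ (con 1ℚ :+ n)) :* j
                   := (x :- con 1ℚ) :* j :* (b :* (x :+ n) :* i)) refl
               X (1/suc k) (newtonBasis k X) (ℕtoℚ k) (1/suc (suc k)) ⟩
    (X - 1ℚ) * 1/suc (suc k) * (newtonBasis k X * (X + ℕtoℚ k) * 1/suc k) ∎
    where open ≡-Reasoning

  Δ-newtonBasis : ∀ k X → Δ (newtonBasis (suc k)) X ≡ newtonBasis k X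
  Δ-newtonBasis k X = begin
    B * (X + ℕtoℚ k) * 1/suc k - newtonBasis (suc k) (X - 1ℚ)
      ≡⟨ cong (B * (X + ℕtoℚ k) * 1/suc k -_) (newtonBasis-shift k X) ⟩
    B * (X + ℕtoℚ k) * 1/suc k - (X - 1ℚ) * 1/suc k * B
      ≡⟨ solve 4 (λ b x n i → b :* (x :+ n) :* i :- (x :- con 1ℚ) :* i :* b := b :* (i :* (con 1ℚ :+ n)))
               refl B X (ℕtoℚ k) (1/suc k) ⟩
    B * (1/suc k * (1ℚ + ℕtoℚ k))
      ≡⟨ cong (λ z → B * (1/suc k * z)) (sym (ℕtoℚ-suc k)) ⟩
    B * (1/suc k * ℕtoℚ (suc k))
      ≡⟨ cong (B *_) (1/suc-inverseˡ k) ⟩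
    B * 1ℚ
      ≡⟨ ℚP.*-identityʳ B ⟩
    B ∎
    where
    open ≡-Reasoning
    B = newtonBasis k X

  iterΔ-suc : ∀ i h X → iter (suc i) Δ h X ≡ iter i Δ (Δ h) X
  iterΔ-suc zero    h X = refl
  iterΔ-suc (suc i) h X = cong₂ _-_ (iterΔ-suc i h X) (iterΔ-suc i h (X - 1ℚ))

  iterΔ-newtonBasis : ∀ i r X → iter i Δ (newtonBasis (i ℕ.+ r)) X ≡ newtonBasis r X
  iterΔ-newtonBasis zero    r X = refl
  iterΔ-newtonBasis (suc i) r X =
    trans (iterΔ-suc i (newtonBasis (suc (i ℕ.+ r))) X)
          (trans (iterΔ-cong (Δ-newtonBasis (i ℕ.+ r)) i X) (iterΔ-newtonBasis i r X))

  Degree≤-newtonBasis : ∀ k → Degree≤ k (newtonBasis k)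
  Degree≤-newtonBasis k X = trans (cong₂ _-_ (top X) (top (X - 1ℚ))) (ℚP.+-inverseʳ 1ℚ)
    where
    top : ∀ X → iter k Δ (newtonBasis k) X ≡ 1ℚ
    top X = trans (iterΔ-cong (λ Z → cong (λ z → newtonBasis z Z) (sym (ℕP.+-identityʳ k))) k X)
                  (iterΔ-newtonBasis k 0 X)

  kronecker : ℕ → ℕ → ℚ
  kronecker i r = if i ≡ᵇ r then 1ℚ else 0ℚ

  newtonBasis-0 : ∀ r → newtonBasis r 0ℚ ≡ kronecker 0 r
  newtonBasis-0 zero          = refl
  newtonBasis-0 (suc zero)    = refl
  newtonBasis-0 (suc (suc r)) =
    trans (cong (λ z → z * (0ℚ + ℕtoℚ (suc r)) * 1/suc (suc r)) (newtonBasis-0 (suc r)))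
          (solve 2 (λ a b → con 0ℚ :* a :* b := con 0ℚ) refl (0ℚ + ℕtoℚ (suc r)) (1/suc (suc r)))

  kronecker-+ : ∀ i e → kronecker i (i ℕ.+ e) ≡ kronecker 0 e
  kronecker-+ zero    e = refl
  kronecker-+ (suc i) e = kronecker-+ i e

  kronecker-> : ∀ i r → r < i → kronecker i r ≡ 0ℚ
  kronecker-> (suc i) zero    _         = refl
  kronecker-> (suc i) (suc r) (s≤s r<i) = kronecker-> i r r<i

  iterΔ-newtonBasis-0 : ∀ i r → iter i Δ (newtonBasis r) 0ℚ ≡ kronecker i r
  iterΔ-newtonBasis-0 i r with i ℕ.≤? r
  ... | yes i≤r = subst (λ z → iter i Δ (newtonBasis z) 0ℚ ≡ kronecker i z) (ℕP.m+[n∸m]≡n i≤r) below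
    where
    below : iter i Δ (newtonBasis (i ℕ.+ (r ∸ i))) 0ℚ ≡ kronecker i (i ℕ.+ (r ∸ i))
    below = trans (iterΔ-newtonBasis i (r ∸ i) 0ℚ)
                  (trans (newtonBasis-0 (r ∸ i)) (sym (kronecker-+ i (r ∸ i))))
  ... | no  i≰r = above i (ℕP.≰⇒> i≰r)
    where
    above : ∀ i → r < i → iter i Δ (newtonBasis r) 0ℚ ≡ kronecker i r
    above (suc i) (s≤s r≤i) =
      trans (Degree≤-mono r i (newtonBasis r) r≤i (Degree≤-newtonBasis r) 0ℚ)
            (sym (kronecker-> (suc i) r (s≤s r≤i)))

  sumFin-kronecker : ∀ D i (g : ℕ → ℚ) → i < D →
                     sumFin D (λ k → kronecker i (toℕ k) * g (toℕ k)) ≡ g i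
  sumFin-kronecker (suc D) zero g _ =
    trans (cong₂ _+_ (ℚP.*-identityˡ (g 0)) (sumFin-zero D (λ k → ℚP.*-zeroˡ (g (suc (toℕ k))))))
          (ℚP.+-identityʳ (g 0))
  sumFin-kronecker (suc D) (suc i) g (s≤s i<D) =
    trans (cong₂ _+_ (ℚP.*-zeroˡ (g 0)) (sumFin-kronecker D i (λ z → g (suc z)) i<D))
          (ℚP.+-identityˡ (g (suc i)))

module NewtonPolynomial where

  open import Data.Nat as ℕ using (ℕ; zero; suc; _≤_; z≤n; s≤s)
  import Data.Nat.Properties as ℕP
  open import Data.Fin using (Fin; toℕ; zero; suc)
  open import Data.Fin.Properties using (toℕ≤pred[n])
  open import Data.List using (List; []; _∷_; length)
  open import Data.Rational using (ℚ; 0ℚ; 1ℚ; _+_; _*_)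
  import Data.Rational.Properties as ℚP
  open import Data.Rational.Solver
  open import Relation.Binary.PropositionalEquality
  open +-*-Solver
  open ℕtoℚ-Properties
  open FinSum
  open Differences
  open NewtonBasis

  horner : List ℚ → ℚ → ℚ
  horner []      X = 0ℚ
  horner (a ∷ p) X = a + X * horner p X

  coeff : List ℚ → ℕ → ℚ
  coeff []      _       = 0ℚ
  coeff (a ∷ p) zero    = a
  coeff (a ∷ p) (suc e) = coeff p e

  scaleCoeffs : ℚ → List ℚ → List ℚ
  scaleCoeffs c []      = []
  scaleCoeffs c (a ∷ p) = c * a ∷ scaleCoeffs c p

  addCoeffs : List ℚ → List ℚ → List ℚ
  addCoeffs []      q       = q
  addCoeffs (a ∷ p) []      = a ∷ p
  addCoeffs (a ∷ p) (b ∷ q) = a + b ∷ addCoeffs p q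

  horner-scale : ∀ c p X → horner (scaleCoeffs c p) X ≡ c * horner p X
  horner-scale c []      X = sym (ℚP.*-zeroʳ c)
  horner-scale c (a ∷ p) X =
    trans (cong (λ z → c * a + X * z) (horner-scale c p X))
          (solve 4 (λ c a x e → c :* a :+ x :* (c :* e) := c :* (a :+ x :* e)) refl c a X (horner p X))

  horner-add : ∀ p q X → horner (addCoeffs p q) X ≡ horner p X + horner q X
  horner-add []      q       X = sym (ℚP.+-identityˡ (horner q X))
  horner-add (a ∷ p) []      X = sym (ℚP.+-identityʳ (horner (a ∷ p) X))
  horner-add (a ∷ p) (b ∷ q) X =
    trans (cong (λ z → a + b + X * z) (horner-add p q X))
          (solve 5 (λ a b x e f → a :+ b :+ x :* (e :+ f) := (a :+ x :* e) :+ (b :+ x :* f)) refl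
                 a b X (horner p X) (horner q X))

  length-scale : ∀ c p → length (scaleCoeffs c p) ≡ length p
  length-scale c []      = refl
  length-scale c (a ∷ p) = cong suc (length-scale c p)

  length-add : ∀ p q D → length p ≤ D → length q ≤ D → length (addCoeffs p q) ≤ D
  length-add []      q       D       _         h         = h
  length-add (a ∷ p) []      D       h         _         = h
  length-add (a ∷ p) (b ∷ q) (suc D) (s≤s h₁) (s≤s h₂) = s≤s (length-add p q D h₁ h₂)

  horner-sumFin : ∀ p D X → length p ≤ D → horner p X ≡ sumFin D (λ e → coeff p (toℕ e) * powℚ X (toℕ e))
  horner-sumFin []      D       X _       = sym (sumFin-zero D (λ e → ℚP.*-zeroˡ (powℚ X (toℕ e))))
  horner-sumFin (a ∷ p) (suc D) X (s≤s h) = begin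
    a + X * horner p X
      ≡⟨ cong (λ z → a + X * z) (horner-sumFin p D X h) ⟩
    a + X * sumFin D (λ e → coeff p (toℕ e) * powℚ X (toℕ e))
      ≡⟨ cong₂ _+_ (sym (ℚP.*-identityʳ a)) (sumFin-*ˡ D _ X) ⟩
    a * 1ℚ + sumFin D (λ e → X * (coeff p (toℕ e) * powℚ X (toℕ e)))
      ≡⟨ cong (a * 1ℚ +_) (sumFin-cong D (λ e →
           solve 3 (λ x c w → x :* (c :* w) := c :* (x :* w)) refl X (coeff p (toℕ e)) (powℚ X (toℕ e)))) ⟩
    sumFin (suc D) (λ e → coeff (a ∷ p) (toℕ e) * powℚ X (toℕ e)) ∎
    where open ≡-Reasoning

  newtonBasisCoeffs : ℕ → List ℚ
  newtonBasisCoeffs zero    = 1ℚ ∷ []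
  newtonBasisCoeffs (suc k) =
    scaleCoeffs (1/suc k) (addCoeffs (0ℚ ∷ newtonBasisCoeffs k) (scaleCoeffs (ℕtoℚ k) (newtonBasisCoeffs k)))

  horner-newtonBasisCoeffs : ∀ k X → horner (newtonBasisCoeffs k) X ≡ newtonBasis k X
  horner-newtonBasisCoeffs zero X = solve 1 (λ x → con 1ℚ :+ x :* con 0ℚ := con 1ℚ) refl X
  horner-newtonBasisCoeffs (suc k) X = begin
    horner (scaleCoeffs (1/suc k) (addCoeffs (0ℚ ∷ C) (scaleCoeffs (ℕtoℚ k) C))) X
      ≡⟨ horner-scale (1/suc k) (addCoeffs (0ℚ ∷ C) (scaleCoeffs (ℕtoℚ k) C)) X ⟩
    1/suc k * horner (addCoeffs (0ℚ ∷ C) (scaleCoeffs (ℕtoℚ k) C)) X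
      ≡⟨ cong (1/suc k *_) (horner-add (0ℚ ∷ C) (scaleCoeffs (ℕtoℚ k) C) X) ⟩
    1/suc k * ((0ℚ + X * horner C X) + horner (scaleCoeffs (ℕtoℚ k) C) X)
      ≡⟨ cong₂ (λ a b → 1/suc k * ((0ℚ + X * a) + b)) (horner-newtonBasisCoeffs k X)
               (trans (horner-scale (ℕtoℚ k) C X) (cong (ℕtoℚ k *_) (horner-newtonBasisCoeffs k X))) ⟩
    1/suc k * ((0ℚ + X * B) + ℕtoℚ k * B)
      ≡⟨ solve 4 (λ i x b n → i :* ((con 0ℚ :+ x :* b) :+ n :* b) := b :* (x :+ n) :* i) refl
               (1/suc k) X B (ℕtoℚ k) ⟩
    newtonBasis (suc k) X ∎
    where
    open ≡-Reasoning
    C = newtonBasisCoeffs k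
    B = newtonBasis k X

  length-newtonBasisCoeffs : ∀ k → length (newtonBasisCoeffs k) ≤ suc k
  length-newtonBasisCoeffs zero    = s≤s z≤n
  length-newtonBasisCoeffs (suc k) =
    subst (_≤ suc (suc k)) (sym (length-scale (1/suc k) (addCoeffs (0ℚ ∷ C) (scaleCoeffs (ℕtoℚ k) C))))
      (length-add (0ℚ ∷ C) (scaleCoeffs (ℕtoℚ k) C) (suc (suc k)) (s≤s (length-newtonBasisCoeffs k))
        (subst (_≤ suc (suc k)) (sym (length-scale (ℕtoℚ k) C)) (ℕP.m≤n⇒m≤1+n (length-newtonBasisCoeffs k))))
    where C = newtonBasisCoeffs k

  newtonCoeff : ℕ → ℕ → ℚ
  newtonCoeff r e = coeff (newtonBasisCoeffs r) e

  newtonBasis-monomials : ∀ m r X → r ≤ m →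
    newtonBasis r X ≡ sumFin (suc m) (λ e → newtonCoeff r (toℕ e) * powℚ X (toℕ e))
  newtonBasis-monomials m r X r≤m =
    trans (sym (horner-newtonBasisCoeffs r X))
          (horner-sumFin (newtonBasisCoeffs r) (suc m) X (ℕP.≤-trans (length-newtonBasisCoeffs r) (s≤s r≤m)))

  separableSum-change-of-basis :
    ∀ K L K′ L′ (c : Fin K → Fin L → ℚ) (a : Fin K → Fin K′ → ℚ) (b : Fin L → Fin L′ → ℚ)
      (x : Fin K′ → ℚ) (y : Fin L′ → ℚ) →
    sumFin K′ (λ k′ → sumFin L′ (λ l′ →
      sumFin K (λ k → sumFin L (λ l → c k l * (a k k′ * b l l′))) * (x k′ * y l′)))
    ≡ sumFin K (λ k → sumFin L (λ l →
      c k l * (sumFin K′ (λ k′ → a k k′ * x k′) * sumFin L′ (λ l′ → b l l′ * y l′))))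
  separableSum-change-of-basis K L K′ L′ c a b x y = begin
    sumFin K′ (λ k′ → sumFin L′ (λ l′ →
      sumFin K (λ k → sumFin L (λ l → c k l * (a k k′ * b l l′))) * (x k′ * y l′)))
      ≡⟨ sumFin-cong K′ (λ k′ → sumFin-cong L′ (λ l′ → trans (sumFin-*ʳ K _ _)
           (sumFin-cong K (λ k → trans (sumFin-*ʳ L _ _) (sumFin-cong L (λ l →
             solve 5 (λ c a b x y → c :* (a :* b) :* (x :* y) := c :* ((a :* x) :* (b :* y))) refl
                   (c k l) (a k k′) (b l l′) (x k′) (y l′))))))) ⟩
    sumFin K′ (λ k′ → sumFin L′ (λ l′ → sumFin K (λ k → sumFin L (λ l → T k l k′ l′))))
      ≡⟨ sumFin-cong K′ (λ k′ → sumFin-swap L′ K (λ l′ k → sumFin L (λ l → T k l k′ l′))) ⟩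
    sumFin K′ (λ k′ → sumFin K (λ k → sumFin L′ (λ l′ → sumFin L (λ l → T k l k′ l′))))
      ≡⟨ sumFin-swap K′ K _ ⟩
    sumFin K (λ k → sumFin K′ (λ k′ → sumFin L′ (λ l′ → sumFin L (λ l → T k l k′ l′))))
      ≡⟨ sumFin-cong K (λ k → sumFin-cong K′ (λ k′ → sumFin-swap L′ L (λ l′ l → T k l k′ l′))) ⟩
    sumFin K (λ k → sumFin K′ (λ k′ → sumFin L (λ l → sumFin L′ (λ l′ → T k l k′ l′))))
      ≡⟨ sumFin-cong K (λ k → sumFin-swap K′ L (λ k′ l → sumFin L′ (λ l′ → T k l k′ l′))) ⟩
    sumFin K (λ k → sumFin L (λ l → sumFin K′ (λ k′ → sumFin L′ (λ l′ → T k l k′ l′))))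
      ≡⟨ sumFin-cong K (λ k → sumFin-cong L (λ l → sym (expand k l))) ⟩
    sumFin K (λ k → sumFin L (λ l →
      c k l * (sumFin K′ (λ k′ → a k k′ * x k′) * sumFin L′ (λ l′ → b l l′ * y l′)))) ∎
    where
    open ≡-Reasoning
    T : Fin K → Fin L → Fin K′ → Fin L′ → ℚ
    T k l k′ l′ = c k l * ((a k k′ * x k′) * (b l l′ * y l′))
    expand : ∀ k l → c k l * (sumFin K′ (λ k′ → a k k′ * x k′) * sumFin L′ (λ l′ → b l l′ * y l′))
                     ≡ sumFin K′ (λ k′ → sumFin L′ (λ l′ → T k l k′ l′))
    expand k l = begin
      c k l * (sumFin K′ (λ k′ → a k k′ * x k′) * sumFin L′ (λ l′ → b l l′ * y l′))
        ≡⟨ cong (c k l *_) (trans (sumFin-*ʳ K′ (λ k′ → a k k′ * x k′) _)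
             (sumFin-cong K′ (λ k′ → sumFin-*ˡ L′ (λ l′ → b l l′ * y l′) (a k k′ * x k′)))) ⟩
      c k l * sumFin K′ (λ k′ → sumFin L′ (λ l′ → (a k k′ * x k′) * (b l l′ * y l′)))
        ≡⟨ trans (sumFin-*ˡ K′ _ (c k l)) (sumFin-cong K′ (λ k′ → sumFin-*ˡ L′ _ (c k l))) ⟩
      sumFin K′ (λ k′ → sumFin L′ (λ l′ → T k l k′ l′)) ∎

  newtonPoly : ∀ m n → (ℕ → ℕ → ℚ) → Poly m n
  newtonPoly m n C k′ l′ = sumFin (suc m) λ k → sumFin (suc n) λ l →
    C (toℕ k) (toℕ l) * (newtonCoeff (toℕ k) (toℕ k′) * newtonCoeff (toℕ l) (toℕ l′))

  eval-newtonPoly : ∀ m n C X Y → eval (newtonPoly m n C) X Y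
    ≡ separableSum (suc m) (suc n) (λ k l → C (toℕ k) (toℕ l))
                   (λ k → newtonBasis (toℕ k)) (λ l → newtonBasis (toℕ l)) X Y
  eval-newtonPoly m n C X Y =
    trans (separableSum-change-of-basis (suc m) (suc n) (suc m) (suc n) (λ k l → C (toℕ k) (toℕ l))
             (λ k k′ → newtonCoeff (toℕ k) (toℕ k′)) (λ l l′ → newtonCoeff (toℕ l) (toℕ l′))
             (λ k′ → powℚ X (toℕ k′)) (λ l′ → powℚ Y (toℕ l′)))
      (sumFin-cong (suc m) (λ k → sumFin-cong (suc n) (λ l → cong (C (toℕ k) (toℕ l) *_)
        (sym (cong₂ _*_ (newtonBasis-monomials m (toℕ k) X (toℕ≤pred[n] k))
                        (newtonBasis-monomials n (toℕ l) Y (toℕ≤pred[n] l)))))))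

  newtonPoly-ΔXY-0 : ∀ m n C i j → i ≤ m → j ≤ n → ΔXY i j (eval (newtonPoly m n C)) 0ℚ 0ℚ ≡ C i j
  newtonPoly-ΔXY-0 m n C i j i≤m j≤n = begin
    ΔXY i j (eval (newtonPoly m n C)) 0ℚ 0ℚ
      ≡⟨ iterΔX-cong (λ X Y → iterΔY-cong (eval-newtonPoly m n C) j X Y) i 0ℚ 0ℚ ⟩
    ΔXY i j (separableSum (suc m) (suc n) C′ (λ k → newtonBasis (toℕ k)) (λ l → newtonBasis (toℕ l))) 0ℚ 0ℚ
      ≡⟨ ΔXY-separableSum i j (suc m) (suc n) C′
           (λ k → newtonBasis (toℕ k)) (λ l → newtonBasis (toℕ l)) 0ℚ 0ℚ ⟩
    sumFin (suc m) (λ k → sumFin (suc n) (λ l →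
      C′ k l * (iter i Δ (newtonBasis (toℕ k)) 0ℚ * iter j Δ (newtonBasis (toℕ l)) 0ℚ)))
      ≡⟨ sumFin-cong (suc m) (λ k → sumFin-cong (suc n) (λ l →
           cong₂ (λ a b → C′ k l * (a * b)) (iterΔ-newtonBasis-0 i (toℕ k)) (iterΔ-newtonBasis-0 j (toℕ l)))) ⟩
    sumFin (suc m) (λ k → sumFin (suc n) (λ l → C′ k l * (kronecker i (toℕ k) * kronecker j (toℕ l))))
      ≡⟨ sumFin-cong (suc m) row ⟩
    sumFin (suc m) (λ k → kronecker i (toℕ k) * C (toℕ k) j)
      ≡⟨ sumFin-kronecker (suc m) i (λ k → C k j) (s≤s i≤m) ⟩
    C i j ∎
    where
    open ≡-Reasoning
    C′ : Fin (suc m) → Fin (suc n) → ℚ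
    C′ k l = C (toℕ k) (toℕ l)
    row : ∀ k → sumFin (suc n) (λ l → C′ k l * (kronecker i (toℕ k) * kronecker j (toℕ l)))
                ≡ kronecker i (toℕ k) * C (toℕ k) j
    row k = begin
      sumFin (suc n) (λ l → C′ k l * (kronecker i (toℕ k) * kronecker j (toℕ l)))
        ≡⟨ sumFin-cong (suc n) (λ l → solve 3 (λ c a b → c :* (a :* b) := a :* (b :* c)) refl
                                         (C′ k l) (kronecker i (toℕ k)) (kronecker j (toℕ l))) ⟩
      sumFin (suc n) (λ l → kronecker i (toℕ k) * (kronecker j (toℕ l) * C′ k l))
        ≡⟨ sumFin-*ˡ (suc n) (λ l → kronecker j (toℕ l) * C′ k l) (kronecker i (toℕ k)) ⟨
      kronecker i (toℕ k) * sumFin (suc n) (λ l → kronecker j (toℕ l) * C (toℕ k) (toℕ l))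
        ≡⟨ cong (kronecker i (toℕ k) *_) (sumFin-kronecker (suc n) j (C (toℕ k)) (s≤s j≤n)) ⟩
      kronecker i (toℕ k) * C (toℕ k) j ∎

module ListSum where

  open import Data.Nat using (ℕ; zero; suc; _+_; _≤_; _<_; s≤s; _≡ᵇ_; _≤ᵇ_; _<ᵇ_)
  import Data.Nat.Properties as ℕP
  open import Algebra.Properties.CommutativeSemigroup ℕP.+-commutativeSemigroup using (interchange)
  open import Data.Bool using (Bool; true; false; _∧_; if_then_else_)
  open import Data.Sum using (inj₁; inj₂)
  open import Data.Product using (_×_; _,_)
  open import Data.List using (List; []; _∷_; map; _++_; length; cartesianProduct; filterᵇ; upTo; concatMap)
  import Data.List.Properties as LP
  open import Data.List.Relation.Unary.All using (All; []; _∷_)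
  open import Function using (_∘_)
  open import Relation.Binary.PropositionalEquality

  private variable A B : Set

  sumOver : List A → (A → ℕ) → ℕ
  sumOver []       f = 0
  sumOver (x ∷ xs) f = f x + sumOver xs f

  indicator : Bool → ℕ
  indicator b = if b then 1 else 0

  if-∧ : ∀ a b (g : ℕ) → (if a ∧ b then g else 0) ≡ (if a then (if b then g else 0) else 0)
  if-∧ true  b g = refl
  if-∧ false b g = refl

  sumOver-cong : (xs : List A) {f g : A → ℕ} → (∀ a → f a ≡ g a) → sumOver xs f ≡ sumOver xs g
  sumOver-cong []       eq = refl
  sumOver-cong (x ∷ xs) eq = cong₂ _+_ (eq x) (sumOver-cong xs eq)

  sumOver-congAll : {xs : List A} {f g : A → ℕ} → All (λ a → f a ≡ g a) xs → sumOver xs f ≡ sumOver xs g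
  sumOver-congAll []       = refl
  sumOver-congAll (e ∷ es) = cong₂ _+_ e (sumOver-congAll es)

  sumOver-zero : (xs : List A) {f : A → ℕ} → (∀ a → f a ≡ 0) → sumOver xs f ≡ 0
  sumOver-zero []       eq = refl
  sumOver-zero (x ∷ xs) eq = cong₂ _+_ (eq x) (sumOver-zero xs eq)

  sumOver-++ : (xs ys : List A) (f : A → ℕ) → sumOver (xs ++ ys) f ≡ sumOver xs f + sumOver ys f
  sumOver-++ []       ys f = refl
  sumOver-++ (x ∷ xs) ys f = trans (cong (f x +_) (sumOver-++ xs ys f)) (sym (ℕP.+-assoc (f x) _ _))

  sumOver-map : (g : A → B) (xs : List A) (f : B → ℕ) → sumOver (map g xs) f ≡ sumOver xs (f ∘ g)
  sumOver-map g []       f = refl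
  sumOver-map g (x ∷ xs) f = cong (f (g x) +_) (sumOver-map g xs f)

  sumOver-+ : (xs : List A) (f g : A → ℕ) → sumOver xs (λ a → f a + g a) ≡ sumOver xs f + sumOver xs g
  sumOver-+ []       f g = refl
  sumOver-+ (x ∷ xs) f g =
    trans (cong (f x + g x +_) (sumOver-+ xs f g)) (interchange (f x) (g x) (sumOver xs f) (sumOver xs g))

  sumOver-concatMap : (g : A → List B) (xs : List A) (f : B → ℕ) →
                      sumOver (concatMap g xs) f ≡ sumOver xs (λ a → sumOver (g a) f)
  sumOver-concatMap g []       f = refl
  sumOver-concatMap g (x ∷ xs) f =
    trans (sumOver-++ (g x) (concatMap g xs) f) (cong (sumOver (g x) f +_) (sumOver-concatMap g xs f))

  sumOver-if : (xs : List A) (c : Bool) (h : A → ℕ) →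
               sumOver xs (λ a → if c then h a else 0) ≡ (if c then sumOver xs h else 0)
  sumOver-if xs true  h = refl
  sumOver-if xs false h = sumOver-zero xs (λ _ → refl)

  sumOver-filter : (P : A → Bool) (xs : List A) (f : A → ℕ) →
                   sumOver (filterᵇ P xs) f ≡ sumOver xs (λ a → if P a then f a else 0)
  sumOver-filter P []       f = refl
  sumOver-filter P (x ∷ xs) f with P x
  ... | true  = cong (f x +_) (sumOver-filter P xs f)
  ... | false = sumOver-filter P xs f

  length≡sumOver : (xs : List A) → length xs ≡ sumOver xs (λ _ → 1)
  length≡sumOver []       = refl
  length≡sumOver (x ∷ xs) = cong suc (length≡sumOver xs)

  sumOver-cartesianProduct : (xs : List A) (ys : List B) (f : A × B → ℕ) →
    sumOver (cartesianProduct xs ys) f ≡ sumOver xs (λ a → sumOver ys (λ b → f (a , b)))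
  sumOver-cartesianProduct []       ys f = refl
  sumOver-cartesianProduct (x ∷ xs) ys f =
    trans (sumOver-++ (map (x ,_) ys) _ f)
          (cong₂ _+_ (sumOver-map (x ,_) ys f) (sumOver-cartesianProduct xs ys f))

  sumBelow : ℕ → (ℕ → ℕ) → ℕ
  sumBelow zero    h = 0
  sumBelow (suc K) h = sumBelow K h + h K

  sumOver-upTo : ∀ K h → sumOver (upTo K) h ≡ sumBelow K h
  sumOver-upTo zero    h = refl
  sumOver-upTo (suc K) h =
    trans (cong (λ z → sumOver z h) (sym (LP.upTo-∷ʳ K)))
          (trans (sumOver-++ (upTo K) (K ∷ []) h) (cong₂ _+_ (sumOver-upTo K h) (ℕP.+-identityʳ (h K))))

  sumBelow-cong : ∀ K {h h′} → (∀ v → v < K → h v ≡ h′ v) → sumBelow K h ≡ sumBelow K h′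
  sumBelow-cong zero    eq = refl
  sumBelow-cong (suc K) eq =
    cong₂ _+_ (sumBelow-cong K (λ v v<K → eq v (ℕP.m<n⇒m<1+n v<K))) (eq K (ℕP.n<1+n K))

  sumBelow-zero : ∀ K h → (∀ v → v < K → h v ≡ 0) → sumBelow K h ≡ 0
  sumBelow-zero zero    h eq = refl
  sumBelow-zero (suc K) h eq =
    cong₂ _+_ (sumBelow-zero K h (λ v v<K → eq v (ℕP.m<n⇒m<1+n v<K))) (eq K (ℕP.n<1+n K))

  sumBelow-+ : ∀ K f g → sumBelow K (λ v → f v + g v) ≡ sumBelow K f + sumBelow K g
  sumBelow-+ zero    f g = refl
  sumBelow-+ (suc K) f g =
    trans (cong (_+ (f K + g K)) (sumBelow-+ K f g)) (interchange (sumBelow K f) (sumBelow K g) (f K) (g K))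

  ≡ᵇ-refl : ∀ v → (v ≡ᵇ v) ≡ true
  ≡ᵇ-refl zero    = refl
  ≡ᵇ-refl (suc v) = ≡ᵇ-refl v

  <⇒≡ᵇ-false : ∀ v w → v < w → (v ≡ᵇ w) ≡ false
  <⇒≡ᵇ-false zero    (suc w) _ = refl
  <⇒≡ᵇ-false (suc v) (suc w) (s≤s v<w) = <⇒≡ᵇ-false v w v<w

  >⇒≡ᵇ-false : ∀ v w → w < v → (v ≡ᵇ w) ≡ false
  >⇒≡ᵇ-false (suc v) zero    _         = refl
  >⇒≡ᵇ-false (suc v) (suc w) (s≤s w<v) = >⇒≡ᵇ-false v w w<v

  sumBelow-delta : ∀ K lo (h : ℕ → ℕ) → lo < K → sumBelow K (λ v → if v ≡ᵇ lo then h v else 0) ≡ h lo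
  sumBelow-delta (suc K) lo h (s≤s lo≤K) with ℕP.m≤n⇒m<n∨m≡n lo≤K
  ... | inj₁ lo<K =
    trans (cong₂ _+_ (sumBelow-delta K lo h lo<K) (cong (λ b → if b then h K else 0) (>⇒≡ᵇ-false K lo lo<K)))
          (ℕP.+-identityʳ (h lo))
  ... | inj₂ refl =
    cong₂ _+_ (sumBelow-zero lo _ (λ v v<lo → cong (λ b → if b then h v else 0) (<⇒≡ᵇ-false v lo v<lo)))
              (cong (λ b → if b then h lo else 0) (≡ᵇ-refl lo))

  ≤ᵇ-suc : ∀ a b → (suc a ≤ᵇ suc b) ≡ (a ≤ᵇ b)
  ≤ᵇ-suc zero    b = refl
  ≤ᵇ-suc (suc a) b = refl

  >⇒≤ᵇ-false : ∀ a b → b < a → (a ≤ᵇ b) ≡ false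
  >⇒≤ᵇ-false (suc a) b (s≤s b≤a) = ≥⇒<ᵇ-false a b b≤a
    where
    ≥⇒<ᵇ-false : ∀ a b → b ≤ a → (a <ᵇ b) ≡ false
    ≥⇒<ᵇ-false a       zero    _         = refl
    ≥⇒<ᵇ-false (suc a) (suc b) (s≤s b≤a) = ≥⇒<ᵇ-false a b b≤a

  if-≤ᵇ-split : ∀ lo v (h : ℕ → ℕ) →
    (if lo ≤ᵇ v then h v else 0) ≡ (if v ≡ᵇ lo then h v else 0) + (if suc lo ≤ᵇ v then h v else 0)
  if-≤ᵇ-split zero     zero    h = sym (ℕP.+-identityʳ (h 0))
  if-≤ᵇ-split zero     (suc v) h = refl
  if-≤ᵇ-split (suc lo) zero    h = refl
  if-≤ᵇ-split (suc lo) (suc v) h rewrite ≤ᵇ-suc lo v | ≤ᵇ-suc (suc lo) v = if-≤ᵇ-split lo v (h ∘ suc)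

module NondecreasingSequences where

  open import Data.Nat using (ℕ; zero; suc; _+_; _∸_; _≤_; _<_; z≤n; s≤s; _≡ᵇ_; _≤ᵇ_)
  import Data.Nat.Properties as ℕP
  open import Data.Bool using (Bool; true; _∧_; if_then_else_)
  open import Data.List using (List; []; _∷_; map; _++_; length; upTo)
  import Data.List.Properties as LP
  open import Data.List.Relation.Unary.All as All using (All; [])
  open import Data.List.Relation.Unary.All.Properties using (map⁺; ++⁺)
  open import Relation.Binary.PropositionalEquality
  open ListSum

  -- the weakly increasing sequences of length k with entries in [lo, lo + c)
  nondecSeqs : (lo c k : ℕ) → List (List ℕ)
  nondecSeqs lo c       zero    = [] ∷ []
  nondecSeqs lo zero    (suc k) = []
  nondecSeqs lo (suc c) (suc k) = map (lo ∷_) (nondecSeqs lo (suc c) k) ++ nondecSeqs (suc lo) c (suc k)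

  length-nondecSeqs : ∀ lo c k → All (λ a → length a ≡ k) (nondecSeqs lo c k)
  length-nondecSeqs lo c       zero    = refl All.∷ []
  length-nondecSeqs lo zero    (suc k) = []
  length-nondecSeqs lo (suc c) (suc k) =
    ++⁺ (map⁺ (All.map (cong suc) (length-nondecSeqs lo (suc c) k))) (length-nondecSeqs (suc lo) c (suc k))

  nondecSeqs-suc : ∀ lo c k → nondecSeqs (suc lo) c k ≡ map (map suc) (nondecSeqs lo c k)
  nondecSeqs-suc lo c       zero    = refl
  nondecSeqs-suc lo zero    (suc k) = refl
  nondecSeqs-suc lo (suc c) (suc k) = begin
    map (suc lo ∷_) (nondecSeqs (suc lo) (suc c) k) ++ nondecSeqs (suc (suc lo)) c (suc k)
      ≡⟨ cong₂ _++_ (cong (map (suc lo ∷_)) (nondecSeqs-suc lo (suc c) k)) (nondecSeqs-suc (suc lo) c (suc k)) ⟩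
    map (suc lo ∷_) (map (map suc) (nondecSeqs lo (suc c) k)) ++ map (map suc) (nondecSeqs (suc lo) c (suc k))
      ≡⟨ cong (_++ map (map suc) (nondecSeqs (suc lo) c (suc k)))
              (trans (sym (LP.map-∘ (nondecSeqs lo (suc c) k))) (LP.map-∘ (nondecSeqs lo (suc c) k))) ⟩
    map (map suc) (map (lo ∷_) (nondecSeqs lo (suc c) k)) ++ map (map suc) (nondecSeqs (suc lo) c (suc k))
      ≡⟨ LP.map-++ (map suc) (map (lo ∷_) (nondecSeqs lo (suc c) k)) (nondecSeqs (suc lo) c (suc k)) ⟨
    map (map suc) (nondecSeqs lo (suc c) (suc k)) ∎
    where open ≡-Reasoning

  sumOver-nondecSeqs-byHead0 : ∀ c k (F G H : List ℕ → ℕ) →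
    (∀ a → F (0 ∷ a) ≡ G a) → (∀ a → length a ≡ suc k → F (map suc a) ≡ H a) →
    sumOver (nondecSeqs 0 (suc c) (suc k)) F ≡ sumOver (nondecSeqs 0 (suc c) k) G + sumOver (nondecSeqs 0 c (suc k)) H
  sumOver-nondecSeqs-byHead0 c k F G H head0 head+ =
    trans (sumOver-++ (map (0 ∷_) (nondecSeqs 0 (suc c) k)) (nondecSeqs 1 c (suc k)) F)
          (cong₂ _+_ (trans (sumOver-map (0 ∷_) (nondecSeqs 0 (suc c) k) F)
                            (sumOver-cong (nondecSeqs 0 (suc c) k) head0))
                     (trans (cong (λ z → sumOver z F) (nondecSeqs-suc 0 c (suc k)))
                            (trans (sumOver-map (map suc) (nondecSeqs 0 c (suc k)) F)
                                   (sumOver-congAll (All.map (λ {a} → head+ a) (length-nondecSeqs 0 c (suc k)))))))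

  nondecFrom : ℕ → List ℕ → Bool
  nondecFrom lo []       = true
  nondecFrom lo (a ∷ as) = (lo ≤ᵇ a) ∧ nondecFrom a as

  nondecr≡nondecFrom0 : ∀ a → nondecr a ≡ nondecFrom 0 a
  nondecr≡nondecFrom0 []           = refl
  nondecr≡nondecFrom0 (a ∷ [])     = refl
  nondecr≡nondecFrom0 (a ∷ b ∷ as) = cong ((a ≤ᵇ b) ∧_) (nondecr≡nondecFrom0 (b ∷ as))

  sumOver-nondecSeqs-byHead : ∀ K k (F : List ℕ → ℕ) c lo → lo + c ≡ K →
    sumOver (nondecSeqs lo c (suc k)) F
      ≡ sumBelow K (λ v → if lo ≤ᵇ v then sumOver (nondecSeqs v (K ∸ v) k) (λ s → F (v ∷ s)) else 0)
  sumOver-nondecSeqs-byHead K k F zero lo lo≡K =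
    sym (sumBelow-zero K _ (λ v v<K → cong (λ b → if b then R v else 0)
           (>⇒≤ᵇ-false lo v (subst (v <_) (trans (sym lo≡K) (ℕP.+-identityʳ lo)) v<K))))
    where R = λ v → sumOver (nondecSeqs v (K ∸ v) k) (λ s → F (v ∷ s))
  sumOver-nondecSeqs-byHead K k F (suc c) lo lo+c≡K = begin
    sumOver (map (lo ∷_) (nondecSeqs lo (suc c) k) ++ nondecSeqs (suc lo) c (suc k)) F
      ≡⟨ sumOver-++ (map (lo ∷_) (nondecSeqs lo (suc c) k)) _ F ⟩
    sumOver (map (lo ∷_) (nondecSeqs lo (suc c) k)) F + sumOver (nondecSeqs (suc lo) c (suc k)) F
      ≡⟨ cong₂ _+_ (trans (sumOver-map (lo ∷_) (nondecSeqs lo (suc c) k) F)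
                          (cong (λ z → sumOver (nondecSeqs lo z k) (λ s → F (lo ∷ s))) c+1≡K∸lo))
                   (sumOver-nondecSeqs-byHead K k F c (suc lo) (trans (sym (ℕP.+-suc lo c)) lo+c≡K)) ⟩
    R lo + sumBelow K (λ v → if suc lo ≤ᵇ v then R v else 0)
      ≡⟨ cong (_+ sumBelow K (λ v → if suc lo ≤ᵇ v then R v else 0)) (sym (sumBelow-delta K lo R lo<K)) ⟩
    sumBelow K (λ v → if v ≡ᵇ lo then R v else 0) + sumBelow K (λ v → if suc lo ≤ᵇ v then R v else 0)
      ≡⟨ sumBelow-+ K _ _ ⟨
    sumBelow K (λ v → (if v ≡ᵇ lo then R v else 0) + (if suc lo ≤ᵇ v then R v else 0))
      ≡⟨ sumBelow-cong K (λ v _ → sym (if-≤ᵇ-split lo v R)) ⟩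
    sumBelow K (λ v → if lo ≤ᵇ v then R v else 0) ∎
    where
    open ≡-Reasoning
    R = λ v → sumOver (nondecSeqs v (K ∸ v) k) (λ s → F (v ∷ s))
    c+1≡K∸lo : suc c ≡ K ∸ lo
    c+1≡K∸lo = sym (trans (cong (_∸ lo) (sym lo+c≡K)) (ℕP.m+n∸m≡n lo (suc c)))
    lo<K : lo < K
    lo<K = subst (lo <_) lo+c≡K (ℕP.m<m+n lo (s≤s z≤n))

  sumOver-seqs-nondecFrom : ∀ k lo c (F : List ℕ → ℕ) →
    sumOver (seqs (lo + c) k) (λ a → if nondecFrom lo a then F a else 0) ≡ sumOver (nondecSeqs lo c k) F
  sumOver-seqs-nondecFrom zero    lo c F = refl
  sumOver-seqs-nondecFrom (suc k) lo c F = begin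
    sumOver (seqs K (suc k)) (λ a → if nondecFrom lo a then F a else 0)
      ≡⟨ sumOver-concatMap (λ v → map (v ∷_) (seqs K k)) (upTo K) _ ⟩
    sumOver (upTo K) (λ v → sumOver (map (v ∷_) (seqs K k)) (λ a → if nondecFrom lo a then F a else 0))
      ≡⟨ sumOver-cong (upTo K) (λ v → trans (sumOver-map (v ∷_) (seqs K k) _) (head-filter v)) ⟩
    sumOver (upTo K) (λ v → if lo ≤ᵇ v then W v else 0)
      ≡⟨ sumOver-upTo K _ ⟩
    sumBelow K (λ v → if lo ≤ᵇ v then W v else 0)
      ≡⟨ sumBelow-cong K (λ v v<K → cong (λ z → if lo ≤ᵇ v then z else 0) (tail-count v (ℕP.<⇒≤ v<K))) ⟩
    sumBelow K (λ v → if lo ≤ᵇ v then sumOver (nondecSeqs v (K ∸ v) k) (λ s → F (v ∷ s)) else 0)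
      ≡⟨ sumOver-nondecSeqs-byHead K k F c lo refl ⟨
    sumOver (nondecSeqs lo c (suc k)) F ∎
    where
    open ≡-Reasoning
    K = lo + c
    W : ℕ → ℕ
    W v = sumOver (seqs K k) (λ s → if nondecFrom v s then F (v ∷ s) else 0)
    head-filter : ∀ v → sumOver (seqs K k) (λ s → if (lo ≤ᵇ v) ∧ nondecFrom v s then F (v ∷ s) else 0)
                        ≡ (if lo ≤ᵇ v then W v else 0)
    head-filter v = trans (sumOver-cong (seqs K k) (λ s → if-∧ (lo ≤ᵇ v) (nondecFrom v s) (F (v ∷ s))))
                          (sumOver-if (seqs K k) (lo ≤ᵇ v) _)
    tail-count : ∀ v → v ≤ K → W v ≡ sumOver (nondecSeqs v (K ∸ v) k) (λ s → F (v ∷ s))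
    tail-count v v≤K =
      trans (cong (λ z → sumOver (seqs z k) (λ s → if nondecFrom v s then F (v ∷ s) else 0))
                  (sym (ℕP.m+[n∸m]≡n v≤K)))
            (sumOver-seqs-nondecFrom k v (K ∸ v) (λ s → F (v ∷ s)))

  sumOver-nondecr-seqs : ∀ k c (F : List ℕ → ℕ) →
    sumOver (seqs c k) (λ a → if nondecr a then F a else 0) ≡ sumOver (nondecSeqs 0 c k) F
  sumOver-nondecr-seqs k c F =
    trans (sumOver-cong (seqs c k) (λ a → cong (λ b → if b then F a else 0) (nondecr≡nondecFrom0 a)))
          (sumOver-seqs-nondecFrom k 0 c F)

module BoundedPaths where

  open import Data.Nat using (ℕ; zero; suc; _+_; _≤_; _<_; z≤n; s≤s; _<ᵇ_)
  import Data.Nat.Properties as ℕP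
  open import Data.Bool using (Bool; true; false; _∧_; _∨_; T)
  import Data.Bool.Properties as BoolP
  open import Data.Bool.ListAction using (any)
  open import Data.Unit using (tt)
  open import Data.Empty using (⊥-elim)
  open import Data.Sum using (_⊎_; inj₁; inj₂)
  open import Data.List using (List; []; _∷_; map; _++_)
  open import Function using (_∘_; flip)
  open import Relation.Binary.PropositionalEquality

  Tests : Set
  Tests = ℕ → ℕ → Bool

  shiftˣ shiftʸ : Tests → Tests
  shiftˣ f k l = f (suc k) l
  shiftʸ f k l = f k (suc l)

  -- Is there a lattice path from (0, 0) to (p, q) whose E-steps from (k, l) all pass the test
  -- E? k l and whose N-steps from (k, l) all pass N? k l?
  pathExists : (E? N? : Tests) (p q : ℕ) → Bool
  pathExists E? N? zero    zero    = true
  pathExists E? N? (suc p) zero    = E? 0 0 ∧ pathExists (shiftˣ E?) (shiftˣ N?) p zero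
  pathExists E? N? zero    (suc q) = N? 0 0 ∧ pathExists (shiftʸ E?) (shiftʸ N?) zero q
  pathExists E? N? (suc p) (suc q) = (E? 0 0 ∧ pathExists (shiftˣ E?) (shiftˣ N?) p (suc q))
                                   ∨ (N? 0 0 ∧ pathExists (shiftʸ E?) (shiftʸ N?) (suc p) q)

  pathExists-cong : ∀ {E₁ N₁ E₂ N₂ : Tests} p q →
    (∀ k l → k < p → l ≤ q → E₁ k l ≡ E₂ k l) →
    (∀ k l → k ≤ p → l < q → N₁ k l ≡ N₂ k l) →
    pathExists E₁ N₁ p q ≡ pathExists E₂ N₂ p q
  pathExists-cong zero    zero    eE eN = refl
  pathExists-cong (suc p) zero    eE eN =
    cong₂ _∧_ (eE 0 0 (s≤s z≤n) z≤n)
              (pathExists-cong p zero (λ k l k<p l≤0 → eE (suc k) l (s≤s k<p) l≤0) (λ _ _ _ ()))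
  pathExists-cong zero    (suc q) eE eN =
    cong₂ _∧_ (eN 0 0 z≤n (s≤s z≤n))
              (pathExists-cong zero q (λ _ _ ()) (λ k l k≤0 l<q → eN k (suc l) k≤0 (s≤s l<q)))
  pathExists-cong (suc p) (suc q) eE eN =
    cong₂ _∨_
      (cong₂ _∧_ (eE 0 0 (s≤s z≤n) z≤n)
                 (pathExists-cong p (suc q) (λ k l k<p l≤q → eE (suc k) l (s≤s k<p) l≤q)
                                            (λ k l k≤p l<q → eN (suc k) l (s≤s k≤p) l<q)))
      (cong₂ _∧_ (eN 0 0 z≤n (s≤s z≤n))
                 (pathExists-cong (suc p) q (λ k l k<p l≤q → eE k (suc l) k<p (s≤s l≤q))
                                            (λ k l k≤p l<q → eN k (suc l) k≤p (s≤s l<q))))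

  pathExists-transpose : ∀ (E? N? : Tests) p q → pathExists E? N? p q ≡ pathExists (flip N?) (flip E?) q p
  pathExists-transpose E? N? zero    zero    = refl
  pathExists-transpose E? N? (suc p) zero    =
    cong (E? 0 0 ∧_) (pathExists-transpose (shiftˣ E?) (shiftˣ N?) p zero)
  pathExists-transpose E? N? zero    (suc q) =
    cong (N? 0 0 ∧_) (pathExists-transpose (shiftʸ E?) (shiftʸ N?) zero q)
  pathExists-transpose E? N? (suc p) (suc q) =
    trans (cong₂ _∨_ (cong (E? 0 0 ∧_) (pathExists-transpose (shiftˣ E?) (shiftˣ N?) p (suc q)))
                     (cong (N? 0 0 ∧_) (pathExists-transpose (shiftʸ E?) (shiftʸ N?) (suc p) q)))
          (BoolP.∨-comm (E? 0 0 ∧ pathExists (flip (shiftˣ N?)) (flip (shiftˣ E?)) (suc q) p)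
                        (N? 0 0 ∧ pathExists (flip (shiftʸ N?)) (flip (shiftʸ E?)) q (suc p)))

  private
    T-∧-intro : ∀ {a b} → T a → T b → T (a ∧ b)
    T-∧-intro {true} _ tb = tb

    T-∧-elimˡ : ∀ {a b} → T (a ∧ b) → T a
    T-∧-elimˡ {true} _ = tt

    T-∧-elimʳ : ∀ {a b} → T (a ∧ b) → T b
    T-∧-elimʳ {true} t = t

    T-∨-introˡ : ∀ {a b} → T a → T (a ∨ b)
    T-∨-introˡ {true} _ = tt

    T-∨-introʳ : ∀ {a b} → T b → T (a ∨ b)
    T-∨-introʳ {true}  _ = tt
    T-∨-introʳ {false} t = t

    T-∨-elim : ∀ {a b} → T (a ∨ b) → T a ⊎ T b
    T-∨-elim {true}  _ = inj₁ tt
    T-∨-elim {false} t = inj₂ t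

    T-ext : ∀ {a b : Bool} → (T a → T b) → (T b → T a) → a ≡ b
    T-ext {true}  {true}  f g = refl
    T-ext {true}  {false} f g = ⊥-elim (f tt)
    T-ext {false} {true}  f g = ⊥-elim (g tt)
    T-ext {false} {false} f g = refl

  -- An admissible path can be made to start with its first E-step, since the N-steps before it
  -- stay admissible one column further right.
  pathExists-freeStepˣ : ∀ (E? N? : Tests) p q → T (E? 0 0) →
    (∀ l → l < q → T (N? 0 l) → T (N? 1 l)) →
    pathExists E? N? (suc p) q ≡ pathExists (shiftˣ E?) (shiftˣ N?) p q
  pathExists-freeStepˣ E? N? p q e₀₀ mono = T-ext (forward E? N? q mono) (backward q)
    where
    backward : ∀ q → T (pathExists (shiftˣ E?) (shiftˣ N?) p q) → T (pathExists E? N? (suc p) q)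
    backward zero    = T-∧-intro e₀₀
    backward (suc _) = T-∨-introˡ ∘ T-∧-intro e₀₀
    forward : ∀ E? N? q → (∀ l → l < q → T (N? 0 l) → T (N? 1 l)) →
              T (pathExists E? N? (suc p) q) → T (pathExists (shiftˣ E?) (shiftˣ N?) p q)
    forward E? N? zero    mono t = T-∧-elimʳ t
    forward E? N? (suc q) mono t with T-∨-elim t
    ... | inj₁ viaE = T-∧-elimʳ viaE
    ... | inj₂ viaN = rejoin p rest
      where
      rest : T (pathExists (shiftˣ (shiftʸ E?)) (shiftˣ (shiftʸ N?)) p q)
      rest = forward (shiftʸ E?) (shiftʸ N?) q (λ l l<q → mono (suc l) (s≤s l<q)) (T-∧-elimʳ viaN)
      n₁₀ : T (N? 1 0)
      n₁₀ = mono 0 (s≤s z≤n) (T-∧-elimˡ viaN)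
      rejoin : ∀ p → T (pathExists (shiftˣ (shiftʸ E?)) (shiftˣ (shiftʸ N?)) p q) →
               T (pathExists (shiftˣ E?) (shiftˣ N?) p (suc q))
      rejoin zero    = T-∧-intro n₁₀
      rejoin (suc p) = T-∨-introʳ ∘ T-∧-intro n₁₀

  pathExists-freeStepʸ : ∀ (E? N? : Tests) p q → T (N? 0 0) →
    (∀ k → k < p → T (E? k 0) → T (E? k 1)) →
    pathExists E? N? p (suc q) ≡ pathExists (shiftʸ E?) (shiftʸ N?) p q
  pathExists-freeStepʸ E? N? p q n₀₀ mono = begin
    pathExists E? N? p (suc q)                            ≡⟨ pathExists-transpose E? N? p (suc q) ⟩
    pathExists (flip N?) (flip E?) (suc q) p              ≡⟨ pathExists-freeStepˣ (flip N?) (flip E?) q p n₀₀ mono ⟩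
    pathExists (shiftˣ (flip N?)) (shiftˣ (flip E?)) q p  ≡⟨ pathExists-transpose (shiftʸ E?) (shiftʸ N?) p q ⟨
    pathExists (shiftʸ E?) (shiftʸ N?) p q                ∎
    where open ≡-Reasoning

  pathExists-blockedˣ : ∀ (E? N? : Tests) p q → E? 0 0 ≡ false → N? 0 0 ≡ false →
                        pathExists E? N? (suc p) q ≡ false
  pathExists-blockedˣ E? N? p zero    e₀₀ n₀₀ rewrite e₀₀ = refl
  pathExists-blockedˣ E? N? p (suc q) e₀₀ n₀₀ rewrite e₀₀ | n₀₀ = refl

  pathExists-blockedʸ : ∀ (E? N? : Tests) q → N? 0 0 ≡ false → pathExists E? N? zero (suc q) ≡ false
  pathExists-blockedʸ E? N? q n₀₀ rewrite n₀₀ = refl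

  boundedTestsˣ : (ℕ → ℕ → ℕ) → List ℕ → (i j : ℕ) → Tests
  boundedTestsˣ u a i j k l = at a (k + i) <ᵇ u (k + i) (l + j)

  boundedTestsʸ : (ℕ → ℕ → ℕ) → List ℕ → (i j : ℕ) → Tests
  boundedTestsʸ v b i j k l = at b (l + j) <ᵇ v (k + i) (l + j)

  private
    any-map : {A B : Set} (f : B → Bool) (g : A → B) (xs : List A) → any f (map g xs) ≡ any (f ∘ g) xs
    any-map f g []       = refl
    any-map f g (x ∷ xs) = cong (f (g x) ∨_) (any-map f g xs)

    any-++ : {A : Set} (f : A → Bool) (xs ys : List A) → any f (xs ++ ys) ≡ any f xs ∨ any f ys
    any-++ f []       ys = refl
    any-++ f (x ∷ xs) ys = trans (cong (f x ∨_) (any-++ f xs ys)) (sym (BoolP.∨-assoc (f x) _ _))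

    any-∧ : {A : Set} (c : Bool) (g : A → Bool) (xs : List A) → any (λ x → c ∧ g x) xs ≡ c ∧ any g xs
    any-∧ true  g xs       = refl
    any-∧ false g []       = refl
    any-∧ false g (x ∷ xs) = any-∧ false g xs

  module _ (u v : ℕ → ℕ → ℕ) (a b : List ℕ) where

    private
      any-E∷ : ∀ i j Ps → any (boundedFrom u v a b i j) (map (E ∷_) Ps)
                          ≡ (at a i <ᵇ u i j) ∧ any (boundedFrom u v a b (suc i) j) Ps
      any-E∷ i j Ps = trans (any-map _ (E ∷_) Ps) (any-∧ (at a i <ᵇ u i j) _ Ps)

      any-N∷ : ∀ i j Ps → any (boundedFrom u v a b i j) (map (N ∷_) Ps)
                          ≡ (at b j <ᵇ v i j) ∧ any (boundedFrom u v a b i (suc j)) Ps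
      any-N∷ i j Ps = trans (any-map _ (N ∷_) Ps) (any-∧ (at b j <ᵇ v i j) _ Ps)

      pathExists-sucˣ : ∀ i j p q →
        pathExists (boundedTestsˣ u a (suc i) j) (boundedTestsʸ v b (suc i) j) p q
          ≡ pathExists (shiftˣ (boundedTestsˣ u a i j)) (shiftˣ (boundedTestsʸ v b i j)) p q
      pathExists-sucˣ i j p q = pathExists-cong p q
        (λ k l _ _ → cong (λ z → at a z <ᵇ u z (l + j)) (ℕP.+-suc k i))
        (λ k l _ _ → cong (λ z → at b (l + j) <ᵇ v z (l + j)) (ℕP.+-suc k i))

      pathExists-sucʸ : ∀ i j p q →
        pathExists (boundedTestsˣ u a i (suc j)) (boundedTestsʸ v b i (suc j)) p q
          ≡ pathExists (shiftʸ (boundedTestsˣ u a i j)) (shiftʸ (boundedTestsʸ v b i j)) p q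
      pathExists-sucʸ i j p q = pathExists-cong p q
        (λ k l _ _ → cong (λ z → at a (k + i) <ᵇ u (k + i) z) (ℕP.+-suc l j))
        (λ k l _ _ → cong (λ z → at b z <ᵇ v (k + i) z) (ℕP.+-suc l j))

    any-paths≡pathExists : ∀ i j p q →
      any (boundedFrom u v a b i j) (paths p q) ≡ pathExists (boundedTestsˣ u a i j) (boundedTestsʸ v b i j) p q
    any-paths≡pathExists i j zero    zero    = refl
    any-paths≡pathExists i j (suc p) zero    =
      trans (any-E∷ i j (paths p zero))
            (cong (_ ∧_) (trans (any-paths≡pathExists (suc i) j p zero) (pathExists-sucˣ i j p zero)))
    any-paths≡pathExists i j zero    (suc q) =
      trans (any-N∷ i j (paths zero q))
            (cong (_ ∧_) (trans (any-paths≡pathExists i (suc j) zero q) (pathExists-sucʸ i j zero q)))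
    any-paths≡pathExists i j (suc p) (suc q) =
      trans (any-++ _ (map (E ∷_) (paths p (suc q))) (map (N ∷_) (paths (suc p) q)))
            (cong₂ _∨_
              (trans (any-E∷ i j (paths p (suc q)))
                     (cong (_ ∧_) (trans (any-paths≡pathExists (suc i) j p (suc q)) (pathExists-sucˣ i j p (suc q)))))
              (trans (any-N∷ i j (paths (suc p) q))
                     (cong (_ ∧_) (trans (any-paths≡pathExists i (suc j) (suc p) q) (pathExists-sucʸ i j (suc p) q)))))

module Recurrence (m n : ℕ) (u v : ℕ → ℕ → ℕ)
  (u-monoˣ : ∀ i j → i < m → j ≤ n → u i j ≤ u (suc i) j)
  (u-monoʸ : ∀ i j → i ≤ m → j < n → u i j ≤ u i (suc j))
  (v-monoˣ : ∀ i j → i < m → j ≤ n → v i j ≤ v (suc i) j)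
  (v-monoʸ : ∀ i j → i ≤ m → j < n → v i j ≤ v i (suc j)) where

  open import Data.Nat as ℕ using (ℕ; zero; suc; _≤_; _<_; _∸_; z≤n; s≤s)
  import Data.Nat.Properties as ℕP
  open import Data.Sum using (inj₁; inj₂)
  open import Data.Empty using (⊥-elim)
  open import Data.Rational using (ℚ; _+_; _-_)
  open import Data.Rational.Solver
  open import Relation.Binary.PropositionalEquality
  open +-*-Solver

  record SatisfiesRecurrence (A : ℕ → ℕ → ℕ → ℕ → ℚ) : Set where
    field
      splitˣ : ∀ i j s t → i < m → j ≤ n → s < u i j → A i j s t ≡ A i j (suc s) t + A (suc i) j s t
      lastˣ  : ∀ j s t → j ≤ n → s < u m j → A m j s t ≡ A m j (suc s) t
      splitʸ : ∀ i j s t → i ≤ m → j < n → t < v i j → A i j s t ≡ A i j s (suc t) + A i (suc j) s t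
      lastʸ  : ∀ i s t → i ≤ m → t < v i n → A i n s t ≡ A i n s (suc t)

  private
    cancel-split : ∀ {a a′ c b b′ c′ : ℚ} →
                   a ≡ a′ + c → b ≡ b′ + c′ → a ≡ b → c ≡ c′ → a′ ≡ b′
    cancel-split {a′ = a′} {c} {b′ = b′} {c′} a≡ b≡ a≡b c≡c′ =
      trans (solve 2 (λ x y → x := (x :+ y) :- y) refl a′ c)
            (trans (cong₂ _-_ (trans (sym a≡) (trans a≡b b≡)) c≡c′)
                   (solve 2 (λ x y → (x :+ y) :- y := x) refl b′ c′))

    combine-split : ∀ {a a′ c b b′ c′ : ℚ} →
                    a ≡ a′ + c → b ≡ b′ + c′ → a′ ≡ b′ → c ≡ c′ → a ≡ b
    combine-split a≡ b≡ a′≡b′ c≡c′ = trans a≡ (trans (cong₂ _+_ a′≡b′ c≡c′) (sym b≡))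

    +-suc≡⇒< : ∀ {s w} e → s ℕ.+ suc e ≡ w → s < w
    +-suc≡⇒< {s} e eq = subst (s <_) eq (ℕP.m<m+n s (s≤s z≤n))

  module _ {A B : ℕ → ℕ → ℕ → ℕ → ℚ} (RA : SatisfiesRecurrence A) (RB : SatisfiesRecurrence B) where
    open SatisfiesRecurrence

    agree-from-origins : (∀ i j → i ≤ m → j ≤ n → A i j 0 0 ≡ B i j 0 0) →
                         ∀ s t i j → i ≤ m → j ≤ n → s ≤ u i j → t ≤ v i j → A i j s t ≡ B i j s t
    agree-from-origins h₀ = agree
      where
      agree₀ : ∀ t i j → i ≤ m → j ≤ n → t ≤ v i j → A i j 0 t ≡ B i j 0 t
      agree₀ zero    i j i≤m j≤n _ = h₀ i j i≤m j≤n
      agree₀ (suc t) i j i≤m j≤n t<v with ℕP.m≤n⇒m<n∨m≡n j≤n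
      ... | inj₁ j<n = cancel-split (splitʸ RA i j 0 t i≤m j<n t<v) (splitʸ RB i j 0 t i≤m j<n t<v)
                         (agree₀ t i j i≤m j≤n (ℕP.<⇒≤ t<v))
                         (agree₀ t i (suc j) i≤m j<n (ℕP.≤-trans (ℕP.<⇒≤ t<v) (v-monoʸ i j i≤m j<n)))
      ... | inj₂ refl = trans (sym (lastʸ RA i 0 t i≤m t<v))
                              (trans (agree₀ t i n i≤m j≤n (ℕP.<⇒≤ t<v)) (lastʸ RB i 0 t i≤m t<v))

      agree : ∀ s t i j → i ≤ m → j ≤ n → s ≤ u i j → t ≤ v i j → A i j s t ≡ B i j s t
      agree zero    t i j i≤m j≤n s≤u t≤v = agree₀ t i j i≤m j≤n t≤v
      agree (suc s) t i j i≤m j≤n s<u t≤v with ℕP.m≤n⇒m<n∨m≡n i≤m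
      ... | inj₁ i<m = cancel-split (splitˣ RA i j s t i<m j≤n s<u) (splitˣ RB i j s t i<m j≤n s<u)
                         (agree s t i j i≤m j≤n (ℕP.<⇒≤ s<u) t≤v)
                         (agree s t (suc i) j i<m j≤n (ℕP.≤-trans (ℕP.<⇒≤ s<u) (u-monoˣ i j i<m j≤n))
                                                    (ℕP.≤-trans t≤v (v-monoˣ i j i<m j≤n)))
      ... | inj₂ refl = trans (sym (lastˣ RA j s t j≤n s<u))
                              (trans (agree s t m j i≤m j≤n (ℕP.<⇒≤ s<u) t≤v) (lastˣ RB j s t j≤n s<u))

    AgreeOnBox : ℕ → ℕ → Set
    AgreeOnBox i j = ∀ s t → s ≤ u i j → t ≤ v i j → A i j s t ≡ B i j s t

    -- Backward induction on the node (i, j) and, inside its box, on the distance to the corner.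
    module FromCorners (h : ∀ i j → i ≤ m → j ≤ n → A i j (u i j) (v i j) ≡ B i j (u i j) (v i j)) where

      agree-box : ∀ i j → i ≤ m → j ≤ n → (i < m → AgreeOnBox (suc i) j) → (j < n → AgreeOnBox i (suc j)) →
                  AgreeOnBox i j
      agree-box i j i≤m j≤n nextˣ nextʸ s t s≤u t≤v = row (u i j ∸ s) s t (ℕP.m+[n∸m]≡n s≤u) t≤v
        where
        column : ∀ e t → t ℕ.+ e ≡ v i j → A i j (u i j) t ≡ B i j (u i j) t
        column zero    t eq = subst (λ z → A i j (u i j) z ≡ B i j (u i j) z)
                                    (sym (trans (sym (ℕP.+-identityʳ t)) eq)) (h i j i≤m j≤n)
        column (suc e) t eq with ℕP.m≤n⇒m<n∨m≡n j≤n
        ... | inj₁ j<n =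
          combine-split (splitʸ RA i j (u i j) t i≤m j<n t<v) (splitʸ RB i j (u i j) t i≤m j<n t<v)
            (column e (suc t) (trans (sym (ℕP.+-suc t e)) eq))
            (nextʸ j<n (u i j) t (u-monoʸ i j i≤m j<n) (ℕP.≤-trans (ℕP.<⇒≤ t<v) (v-monoʸ i j i≤m j<n)))
          where t<v = +-suc≡⇒< e eq
        ... | inj₂ refl =
          trans (lastʸ RA i (u i n) t i≤m t<v)
                (trans (column e (suc t) (trans (sym (ℕP.+-suc t e)) eq)) (sym (lastʸ RB i (u i n) t i≤m t<v)))
          where t<v = +-suc≡⇒< e eq

        row : ∀ e s t → s ℕ.+ e ≡ u i j → t ≤ v i j → A i j s t ≡ B i j s t
        row zero    s t eq t≤v = subst (λ z → A i j z t ≡ B i j z t) (sym (trans (sym (ℕP.+-identityʳ s)) eq))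
                                       (column (v i j ∸ t) t (ℕP.m+[n∸m]≡n t≤v))
        row (suc e) s t eq t≤v with ℕP.m≤n⇒m<n∨m≡n i≤m
        ... | inj₁ i<m =
          combine-split (splitˣ RA i j s t i<m j≤n s<u) (splitˣ RB i j s t i<m j≤n s<u)
            (row e (suc s) t (trans (sym (ℕP.+-suc s e)) eq) t≤v)
            (nextˣ i<m s t (ℕP.≤-trans (ℕP.<⇒≤ s<u) (u-monoˣ i j i<m j≤n))
                           (ℕP.≤-trans t≤v (v-monoˣ i j i<m j≤n)))
          where s<u = +-suc≡⇒< e eq
        ... | inj₂ refl =
          trans (lastˣ RA j s t j≤n s<u)
                (trans (row e (suc s) t (trans (sym (ℕP.+-suc s e)) eq) t≤v) (sym (lastˣ RB j s t j≤n s<u)))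
          where s<u = +-suc≡⇒< e eq

      agree-from-node : ∀ a b i j → i ℕ.+ a ≡ m → j ℕ.+ b ≡ n → AgreeOnBox i j
      agree-from-node a b i j i+a≡m j+b≡n =
        agree-box i j (subst (i ≤_) i+a≡m (ℕP.m≤m+n i a)) (subst (j ≤_) j+b≡n (ℕP.m≤m+n j b))
                  (nextˣ a i+a≡m) (nextʸ b j+b≡n)
        where
        nextˣ : ∀ a → i ℕ.+ a ≡ m → i < m → AgreeOnBox (suc i) j
        nextˣ zero     i+0≡m i<m = ⊥-elim (ℕP.<-irrefl (trans (sym (ℕP.+-identityʳ i)) i+0≡m) i<m)
        nextˣ (suc a′) eq    _   = agree-from-node a′ b (suc i) j (trans (sym (ℕP.+-suc i a′)) eq) j+b≡n
        nextʸ : ∀ b → j ℕ.+ b ≡ n → j < n → AgreeOnBox i (suc j)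
        nextʸ zero     j+0≡n j<n = ⊥-elim (ℕP.<-irrefl (trans (sym (ℕP.+-identityʳ j)) j+0≡n) j<n)
        nextʸ (suc b′) eq    _   = agree-from-node a b′ i (suc j) i+a≡m (trans (sym (ℕP.+-suc j b′)) eq)

    agree-from-corners : (∀ i j → i ≤ m → j ≤ n → A i j (u i j) (v i j) ≡ B i j (u i j) (v i j)) →
                         ∀ s t i j → i ≤ m → j ≤ n → s ≤ u i j → t ≤ v i j → A i j s t ≡ B i j s t
    agree-from-corners h s t i j i≤m j≤n =
      FromCorners.agree-from-node h (m ∸ i) (n ∸ j) i j (ℕP.m+[n∸m]≡n i≤m) (ℕP.m+[n∸m]≡n j≤n) s t

module LatticeCount (x y m n : ℕ) (u v : ℕ → ℕ → ℕ)
  (u≤x : ∀ i j → i ≤ m → j ≤ n → u i j ≤ x)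
  (v≤y : ∀ i j → i ≤ m → j ≤ n → v i j ≤ y)
  (u-monoʸ : ∀ i j → i ≤ m → j < n → u i j ≤ u i (suc j))
  (v-monoˣ : ∀ i j → i < m → j ≤ n → v i j ≤ v (suc i) j) where

  open import Data.Nat using (zero; _+_; _∸_; s≤s; _<ᵇ_)
  import Data.Nat.Properties as ℕP
  open import Data.Bool using (Bool; _∧_; if_then_else_; T)
  open import Data.Product using (_×_; _,_)
  open import Data.List using (List; []; _∷_; map; length; cartesianProduct; filterᵇ)
  open import Data.Bool.ListAction using (any)
  open import Relation.Binary.PropositionalEquality
  open ListSum
  open NondecreasingSequences
  open BoundedPaths

  testsˣ : List ℕ → (i j s : ℕ) → Tests
  testsˣ a i j s k l = at a k <ᵇ u (k + i) (l + j) ∸ s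

  testsʸ : List ℕ → (i j t : ℕ) → Tests
  testsʸ b i j t k l = at b l <ᵇ v (k + i) (l + j) ∸ t

  countIn : (P C Q D i j s t : ℕ) → ℕ
  countIn P C Q D i j s t =
    sumOver (nondecSeqs 0 C P) λ a → sumOver (nondecSeqs 0 D Q) λ b →
      indicator (pathExists (testsˣ a i j s) (testsʸ b i j t) P Q)

  -- count i j s t is the number N i j s t of the proof idea; count 0 0 0 0 is the union count.
  count : (i j s t : ℕ) → ℕ
  count i j s t = countIn (m ∸ i) (x ∸ s) (n ∸ j) (y ∸ t) i j s t

  private
    suc-∸-suc : ∀ a b → b < a → a ∸ b ≡ suc (a ∸ suc b)
    suc-∸-suc (suc a) zero    _         = refl
    suc-∸-suc (suc a) (suc b) (s≤s b<a) = suc-∸-suc a b b<a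

    ∸-∸1 : ∀ w s → w ∸ s ∸ 1 ≡ w ∸ suc s
    ∸-∸1 w s = trans (ℕP.∸-+-assoc w s 1) (cong (w ∸_) (ℕP.+-comm s 1))

    suc-<ᵇ : ∀ c w → (suc c <ᵇ w) ≡ (c <ᵇ w ∸ 1)
    suc-<ᵇ c zero    = refl
    suc-<ᵇ c (suc w) = refl

    at-map-suc : ∀ a k → k < length a → at (map suc a) k ≡ suc (at a k)
    at-map-suc (c ∷ a) zero    _         = refl
    at-map-suc (c ∷ a) (suc k) (s≤s k<n) = at-map-suc a k k<n

    <ᵇ-≤-trans : ∀ c w w′ → w ≤ w′ → T (c <ᵇ w) → T (c <ᵇ w′)
    <ᵇ-≤-trans c w w′ w≤w′ c<w = ℕP.<⇒<ᵇ (ℕP.≤-trans (ℕP.<ᵇ⇒< c w c<w) w≤w′)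

    <∸⇒+< : ∀ {k i m} → i ≤ m → k < m ∸ i → k + i < m
    <∸⇒+< {k} i≤m k<m∸i = ℕP.m≤o∸n⇒m+n≤o (suc k) i≤m k<m∸i

  testsˣ-map-suc : ∀ a i j s k l → k < length a → testsˣ (map suc a) i j s k l ≡ testsˣ a i j (suc s) k l
  testsˣ-map-suc a i j s k l k<len =
    trans (cong (_<ᵇ u (k + i) (l + j) ∸ s) (at-map-suc a k k<len))
          (trans (suc-<ᵇ (at a k) (u (k + i) (l + j) ∸ s)) (cong (at a k <ᵇ_) (∸-∸1 (u (k + i) (l + j)) s)))

  testsʸ-map-suc : ∀ b i j t k l → l < length b → testsʸ (map suc b) i j t k l ≡ testsʸ b i j (suc t) k l
  testsʸ-map-suc b i j t k l l<len =
    trans (cong (_<ᵇ v (k + i) (l + j) ∸ t) (at-map-suc b l l<len))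
          (trans (suc-<ᵇ (at b l) (v (k + i) (l + j) ∸ t)) (cong (at b l <ᵇ_) (∸-∸1 (v (k + i) (l + j)) t)))

  pathExists-headZeroˣ : ∀ a b i j s t p → i < m → j ≤ n → s < u i j →
    pathExists (testsˣ (0 ∷ a) i j s) (testsʸ b i j t) (suc p) (n ∸ j)
      ≡ pathExists (testsˣ a (suc i) j s) (testsʸ b (suc i) j t) p (n ∸ j)
  pathExists-headZeroˣ a b i j s t p i<m j≤n s<u =
    trans (pathExists-freeStepˣ _ _ p (n ∸ j) (ℕP.<⇒<ᵇ (ℕP.m<n⇒0<n∸m s<u)) mono)
          (pathExists-cong p (n ∸ j)
            (λ k l _ _ → cong (λ z → at a k <ᵇ u z (l + j) ∸ s) (sym (ℕP.+-suc k i)))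
            (λ k l _ _ → cong (λ z → at b l <ᵇ v z (l + j) ∸ t) (sym (ℕP.+-suc k i))))
    where
    mono : ∀ l → l < n ∸ j → T (testsʸ b i j t 0 l) → T (testsʸ b i j t 1 l)
    mono l l<n∸j = <ᵇ-≤-trans (at b l) _ _
      (ℕP.∸-monoˡ-≤ t (v-monoˣ i (l + j) i<m (ℕP.<⇒≤ (<∸⇒+< j≤n l<n∸j))))

  pathExists-headZeroʸ : ∀ a b i j s t q → i ≤ m → j < n → t < v i j →
    pathExists (testsˣ a i j s) (testsʸ (0 ∷ b) i j t) (m ∸ i) (suc q)
      ≡ pathExists (testsˣ a i (suc j) s) (testsʸ b i (suc j) t) (m ∸ i) q
  pathExists-headZeroʸ a b i j s t q i≤m j<n t<v =
    trans (pathExists-freeStepʸ _ _ (m ∸ i) q (ℕP.<⇒<ᵇ (ℕP.m<n⇒0<n∸m t<v)) mono)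
          (pathExists-cong (m ∸ i) q
            (λ k l _ _ → cong (λ z → at a k <ᵇ u (k + i) z ∸ s) (sym (ℕP.+-suc l j)))
            (λ k l _ _ → cong (λ z → at b l <ᵇ v (k + i) z ∸ t) (sym (ℕP.+-suc l j))))
    where
    mono : ∀ k → k < m ∸ i → T (testsˣ a i j s k 0) → T (testsˣ a i j s k 1)
    mono k k<m∸i = <ᵇ-≤-trans (at a k) _ _
      (ℕP.∸-monoˡ-≤ s (u-monoʸ (k + i) j (ℕP.<⇒≤ (<∸⇒+< i≤m k<m∸i)) j<n))

  count-splitˣ : ∀ i j s t → i < m → j ≤ n → s < u i j →
                 count i j s t ≡ count i j (suc s) t + count (suc i) j s t
  count-splitˣ i j s t i<m j≤n s<u = begin
    countIn (m ∸ i) (x ∸ s) Q D i j s t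
      ≡⟨ cong₂ (λ P C → countIn P C Q D i j s t) m∸i≡1+p x∸s≡1+c ⟩
    countIn (suc p) (suc c) Q D i j s t
      ≡⟨ sumOver-nondecSeqs-byHead0 c p _ _ _
           (λ a → sumOver-cong (nondecSeqs 0 D Q) (λ b →
              cong indicator (pathExists-headZeroˣ a b i j s t p i<m j≤n s<u)))
           (λ a len → sumOver-cong (nondecSeqs 0 D Q) (λ b → cong indicator (pathExists-cong (suc p) Q
              (λ k l k<p _ → testsˣ-map-suc a i j s k l (subst (k <_) (sym len) k<p)) (λ _ _ _ _ → refl)))) ⟩
    countIn p (suc c) Q D (suc i) j s t + countIn (suc p) c Q D i j (suc s) t
      ≡⟨ ℕP.+-comm (countIn p (suc c) Q D (suc i) j s t) _ ⟩
    countIn (suc p) c Q D i j (suc s) t + countIn p (suc c) Q D (suc i) j s t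
      ≡⟨ cong₂ _+_ (cong (λ P → countIn P c Q D i j (suc s) t) m∸i≡1+p)
                   (cong (λ C → countIn p C Q D (suc i) j s t) x∸s≡1+c) ⟨
    count i j (suc s) t + count (suc i) j s t ∎
    where
    open ≡-Reasoning
    Q = n ∸ j
    D = y ∸ t
    p = m ∸ suc i
    c = x ∸ suc s
    m∸i≡1+p : m ∸ i ≡ suc p
    m∸i≡1+p = suc-∸-suc m i i<m
    x∸s≡1+c : x ∸ s ≡ suc c
    x∸s≡1+c = suc-∸-suc x s (ℕP.≤-trans s<u (u≤x i j (ℕP.<⇒≤ i<m) j≤n))

  count-splitʸ : ∀ i j s t → i ≤ m → j < n → t < v i j →
                 count i j s t ≡ count i j s (suc t) + count i (suc j) s t
  count-splitʸ i j s t i≤m j<n t<v = begin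
    countIn P C (n ∸ j) (y ∸ t) i j s t
      ≡⟨ cong₂ (λ Q D → countIn P C Q D i j s t) n∸j≡1+q y∸t≡1+d ⟩
    countIn P C (suc q) (suc d) i j s t
      ≡⟨ sumOver-cong (nondecSeqs 0 C P) (λ a → sumOver-nondecSeqs-byHead0 d q _ _ _
           (λ b → cong indicator (pathExists-headZeroʸ a b i j s t q i≤m j<n t<v))
           (λ b len → cong indicator (pathExists-cong P (suc q) (λ _ _ _ _ → refl)
              (λ k l _ l<q → testsʸ-map-suc b i j t k l (subst (l <_) (sym len) l<q))))) ⟩
    sumOver (nondecSeqs 0 C P) (λ a → G a + H a)
      ≡⟨ sumOver-+ (nondecSeqs 0 C P) G H ⟩
    countIn P C q (suc d) i (suc j) s t + countIn P C (suc q) d i j s (suc t)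
      ≡⟨ ℕP.+-comm (countIn P C q (suc d) i (suc j) s t) _ ⟩
    countIn P C (suc q) d i j s (suc t) + countIn P C q (suc d) i (suc j) s t
      ≡⟨ cong₂ _+_ (cong (λ Q → countIn P C Q d i j s (suc t)) n∸j≡1+q)
                   (cong (λ D → countIn P C q D i (suc j) s t) y∸t≡1+d) ⟨
    count i j s (suc t) + count i (suc j) s t ∎
    where
    open ≡-Reasoning
    P = m ∸ i
    C = x ∸ s
    q = n ∸ suc j
    d = y ∸ suc t
    G H : List ℕ → ℕ
    G a = sumOver (nondecSeqs 0 (suc d) q) λ b →
            indicator (pathExists (testsˣ a i (suc j) s) (testsʸ b i (suc j) t) P q)
    H a = sumOver (nondecSeqs 0 d (suc q)) λ b →
            indicator (pathExists (testsˣ a i j s) (testsʸ b i j (suc t)) P (suc q))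
    n∸j≡1+q : n ∸ j ≡ suc q
    n∸j≡1+q = suc-∸-suc n j j<n
    y∸t≡1+d : y ∸ t ≡ suc d
    y∸t≡1+d = suc-∸-suc y t (ℕP.≤-trans t<v (v≤y i j i≤m (ℕP.<⇒≤ j<n)))

  count-lastˣ : ∀ j s t → count m j s t ≡ count m j (suc s) t
  count-lastˣ j s t =
    trans (cong (λ P → countIn P (x ∸ s) (n ∸ j) (y ∸ t) m j s t) (ℕP.n∸n≡0 m))
          (trans (cong (_+ 0) (sumOver-cong (nondecSeqs 0 (y ∸ t) (n ∸ j)) (λ b → cong indicator
                   (pathExists-cong 0 (n ∸ j) (λ _ _ ()) (λ _ _ _ _ → refl)))))
                 (cong (λ P → countIn P (x ∸ suc s) (n ∸ j) (y ∸ t) m j (suc s) t) (sym (ℕP.n∸n≡0 m))))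

  count-lastʸ : ∀ i s t → count i n s t ≡ count i n s (suc t)
  count-lastʸ i s t =
    trans (cong (λ Q → countIn (m ∸ i) (x ∸ s) Q (y ∸ t) i n s t) (ℕP.n∸n≡0 n))
          (trans (sumOver-cong (nondecSeqs 0 (x ∸ s) (m ∸ i)) (λ a → cong (λ z → indicator z + 0)
                   (pathExists-cong (m ∸ i) 0 (λ _ _ _ _ → refl) (λ _ _ _ ()))))
                 (cong (λ Q → countIn (m ∸ i) (x ∸ s) Q (y ∸ suc t) i n s (suc t)) (sym (ℕP.n∸n≡0 n))))

  count-cornerˣ : ∀ i j → i < m → count i j (u i j) (v i j) ≡ 0
  count-cornerˣ i j i<m =
    trans (cong (λ P → countIn P (x ∸ u i j) (n ∸ j) (y ∸ v i j) i j (u i j) (v i j)) (suc-∸-suc m i i<m))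
          (sumOver-zero (nondecSeqs 0 (x ∸ u i j) (suc (m ∸ suc i))) (λ a →
            sumOver-zero (nondecSeqs 0 (y ∸ v i j) (n ∸ j)) (λ b → cong indicator
              (pathExists-blockedˣ (testsˣ a i j (u i j)) (testsʸ b i j (v i j)) (m ∸ suc i) (n ∸ j)
                (cong (at a 0 <ᵇ_) (ℕP.n∸n≡0 (u i j))) (cong (at b 0 <ᵇ_) (ℕP.n∸n≡0 (v i j)))))))

  count-cornerʸ : ∀ j → j < n → count m j (u m j) (v m j) ≡ 0
  count-cornerʸ j j<n =
    trans (cong₂ (λ P Q → countIn P (x ∸ u m j) Q (y ∸ v m j) m j (u m j) (v m j))
                 (ℕP.n∸n≡0 m) (suc-∸-suc n j j<n))
          (cong (_+ 0) (sumOver-zero (nondecSeqs 0 (y ∸ v m j) (suc (n ∸ suc j))) (λ b → cong indicator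
            (pathExists-blockedʸ (testsˣ [] m j (u m j)) (testsʸ b m j (v m j)) (n ∸ suc j)
                                 (cong (at b 0 <ᵇ_) (ℕP.n∸n≡0 (v m j)))))))

  count-top : ∀ s t → count m n s t ≡ 1
  count-top s t = cong₂ (λ P Q → countIn P (x ∸ s) Q (y ∸ t) m n s t) (ℕP.n∸n≡0 m) (ℕP.n∸n≡0 n)

  unionCount≡count : unionCount x y m n u v ≡ count 0 0 0 0
  unionCount≡count = begin
    length (filterᵇ bnd (filterᵇ nd pairs))
      ≡⟨ length≡sumOver (filterᵇ bnd (filterᵇ nd pairs)) ⟩
    sumOver (filterᵇ bnd (filterᵇ nd pairs)) (λ _ → 1)
      ≡⟨ sumOver-filter bnd (filterᵇ nd pairs) (λ _ → 1) ⟩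
    sumOver (filterᵇ nd pairs) (λ ab → indicator (bnd ab))
      ≡⟨ sumOver-filter nd pairs (λ ab → indicator (bnd ab)) ⟩
    sumOver pairs (λ ab → if nd ab then indicator (bnd ab) else 0)
      ≡⟨ sumOver-cartesianProduct (seqs x m) (seqs y n) _ ⟩
    sumOver (seqs x m) (λ a → sumOver (seqs y n) (λ b → if nondecr a ∧ nondecr b then I a b else 0))
      ≡⟨ sumOver-cong (seqs x m) (λ a →
           trans (sumOver-cong (seqs y n) (λ b → if-∧ (nondecr a) (nondecr b) (I a b)))
                 (sumOver-if (seqs y n) (nondecr a) _)) ⟩
    sumOver (seqs x m) (λ a → if nondecr a then sumOver (seqs y n) (λ b → if nondecr b then I a b else 0) else 0)
      ≡⟨ sumOver-nondecr-seqs m x _ ⟩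
    sumOver (nondecSeqs 0 x m) (λ a → sumOver (seqs y n) (λ b → if nondecr b then I a b else 0))
      ≡⟨ sumOver-cong (nondecSeqs 0 x m) (λ a → sumOver-nondecr-seqs n y (I a)) ⟩
    sumOver (nondecSeqs 0 x m) (λ a → sumOver (nondecSeqs 0 y n) (I a))
      ≡⟨ sumOver-cong (nondecSeqs 0 x m) (λ a → sumOver-cong (nondecSeqs 0 y n) (λ b → cong indicator
           (trans (any-paths≡pathExists u v a b 0 0 m n) (pathExists-cong m n
             (λ k l _ _ → cong (λ z → at a z <ᵇ u (k + 0) (l + 0)) (ℕP.+-identityʳ k))
             (λ k l _ _ → cong (λ z → at b z <ᵇ v (k + 0) (l + 0)) (ℕP.+-identityʳ l)))))) ⟩
    count 0 0 0 0 ∎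
    where
    open ≡-Reasoning
    pairs : List (List ℕ × List ℕ)
    pairs = cartesianProduct (seqs x m) (seqs y n)
    nd bnd : List ℕ × List ℕ → Bool
    nd (a , b) = nondecr a ∧ nondecr b
    bnd ab = any (λ P → bounded u v P ab) (paths m n)
    I : List ℕ → List ℕ → ℕ
    I a b = indicator (bnd (a , b))

module Corollary (x y m n : ℕ) (xz yz : ℕ → ℕ → ℕ)
    (xz-antitone : ∀ i j i′ j′ → i′ ≤ i → j′ ≤ j → i ≤ m → j ≤ n → xz i j ≤ xz i′ j′)
    (yz-antitone : ∀ i j i′ j′ → i′ ≤ i → j′ ≤ j → i ≤ m → j ≤ n → yz i j ≤ yz i′ j′) where

  open import Data.Nat as ℕ using (_∸_; _!; z≤n)
  import Data.Nat.Properties as ℕP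
  open import Data.Sum using (inj₁; inj₂)
  open import Data.Rational using (ℚ; 0ℚ; 1ℚ; _+_; _*_; _-_; -_)
  import Data.Rational.Properties as ℚP
  open import Data.Rational.Solver
  open import Relation.Binary.PropositionalEquality
  open +-*-Solver
  open ℕtoℚ-Properties
  open Differences
  open NewtonPolynomial
  open ListSum using (≡ᵇ-refl; <⇒≡ᵇ-false)

  u v : ℕ → ℕ → ℕ
  u i j = x ∸ xz i j
  v i j = y ∸ yz i j

  negUX negUY : ℕ → ℕ → ℚ
  negUX i j = - ℕtoℚ (u i j)
  negUY i j = - ℕtoℚ (v i j)

  private
    u-monoˣ : ∀ i j → i < m → j ≤ n → u i j ≤ u (suc i) j
    u-monoˣ i j i<m j≤n = ℕP.∸-monoʳ-≤ x (xz-antitone (suc i) j i j (ℕP.n≤1+n i) ℕP.≤-refl i<m j≤n)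
    u-monoʸ : ∀ i j → i ≤ m → j < n → u i j ≤ u i (suc j)
    u-monoʸ i j i≤m j<n = ℕP.∸-monoʳ-≤ x (xz-antitone i (suc j) i j ℕP.≤-refl (ℕP.n≤1+n j) i≤m j<n)
    v-monoˣ : ∀ i j → i < m → j ≤ n → v i j ≤ v (suc i) j
    v-monoˣ i j i<m j≤n = ℕP.∸-monoʳ-≤ y (yz-antitone (suc i) j i j (ℕP.n≤1+n i) ℕP.≤-refl i<m j≤n)
    v-monoʸ : ∀ i j → i ≤ m → j < n → v i j ≤ v i (suc j)
    v-monoʸ i j i≤m j<n = ℕP.∸-monoʳ-≤ y (yz-antitone i (suc j) i j ℕP.≤-refl (ℕP.n≤1+n j) i≤m j<n)

  open Recurrence m n u v u-monoˣ u-monoʸ v-monoˣ v-monoʸ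
  open LatticeCount x y m n u v (λ i j _ _ → ℕP.m∸n≤m x (xz i j)) (λ i j _ _ → ℕP.m∸n≤m y (yz i j))
                    u-monoʸ v-monoˣ

  m!n! : ℚ
  m!n! = ℕtoℚ (m ! ℕ.* n !)

  scaledCount : ℕ → ℕ → ℕ → ℕ → ℚ
  scaledCount i j s t = m!n! * ℕtoℚ (count i j s t)

  differencesAt : Poly m n → ℕ → ℕ → ℕ → ℕ → ℚ
  differencesAt g i j s t = ΔXY i j (eval g) (- ℕtoℚ s) (- ℕtoℚ t)

  scaledCount-recurrence : SatisfiesRecurrence scaledCount
  scaledCount-recurrence = record
    { splitˣ = λ i j s t i<m j≤n s<u →
        scale-split (count i j (suc s) t) (count (suc i) j s t) (count-splitˣ i j s t i<m j≤n s<u)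
    ; lastˣ  = λ j s t _ _ → cong (λ z → m!n! * ℕtoℚ z) (count-lastˣ j s t)
    ; splitʸ = λ i j s t i≤m j<n t<v →
        scale-split (count i j s (suc t)) (count i (suc j) s t) (count-splitʸ i j s t i≤m j<n t<v)
    ; lastʸ  = λ i s t _ _ → cong (λ z → m!n! * ℕtoℚ z) (count-lastʸ i s t)
    }
    where
    scale-split : ∀ {a} b c → a ≡ b ℕ.+ c → m!n! * ℕtoℚ a ≡ m!n! * ℕtoℚ b + m!n! * ℕtoℚ c
    scale-split b c a≡b+c =
      trans (cong (λ z → m!n! * ℕtoℚ z) a≡b+c)
            (trans (cong (m!n! *_) (ℕtoℚ-+ b c)) (ℚP.*-distribˡ-+ m!n! (ℕtoℚ b) (ℕtoℚ c)))

  differences-recurrence : ∀ g → SatisfiesRecurrence (differencesAt g)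
  differences-recurrence g = record
    { splitˣ = λ i j s t _ _ _ → split-at-s (ΔXY i j (eval g)) s (- ℕtoℚ t)
    ; lastˣ  = λ j s t _ _ → trans (split-at-s (ΔXY m j (eval g)) s (- ℕtoℚ t))
        (trans (cong (differencesAt g m j (suc s) t +_) (ΔXY-eval-vanishˣ g j (- ℕtoℚ s) (- ℕtoℚ t)))
               (ℚP.+-identityʳ _))
    ; splitʸ = λ i j s t _ _ _ → trans (split-at-t (ΔXY i j (eval g)) (- ℕtoℚ s) t)
        (cong (differencesAt g i j s (suc t) +_) (sym (ΔXY-unfoldY i j (eval g) (- ℕtoℚ s) (- ℕtoℚ t))))
    ; lastʸ  = λ i s t _ _ → trans (split-at-t (ΔXY i n (eval g)) (- ℕtoℚ s) t)
        (trans (cong (differencesAt g i n s (suc t) +_)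
                     (trans (sym (ΔXY-unfoldY i n (eval g) (- ℕtoℚ s) (- ℕtoℚ t)))
                            (ΔXY-eval-vanishʸ g i (- ℕtoℚ s) (- ℕtoℚ t))))
               (ℚP.+-identityʳ _))
    }
    where
    split-at-s : ∀ (G : ℚ → ℚ → ℚ) s Y → G (- ℕtoℚ s) Y ≡ G (- ℕtoℚ (suc s)) Y + ΔX G (- ℕtoℚ s) Y
    split-at-s G s Y =
      trans (solve 2 (λ a b → a := b :+ (a :- b)) refl (G (- ℕtoℚ s) Y) (G (- ℕtoℚ s - 1ℚ) Y))
            (cong (λ z → G z Y + ΔX G (- ℕtoℚ s) Y) (sym (-ℕtoℚ-suc s)))
    split-at-t : ∀ (G : ℚ → ℚ → ℚ) X t → G X (- ℕtoℚ t) ≡ G X (- ℕtoℚ (suc t)) + ΔY G X (- ℕtoℚ t)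
    split-at-t G X t =
      trans (solve 2 (λ a b → a := b :+ (a :- b)) refl (G X (- ℕtoℚ t)) (G X (- ℕtoℚ t - 1ℚ)))
            (cong (λ z → G X z + ΔY G X (- ℕtoℚ t)) (sym (-ℕtoℚ-suc t)))

  scaledCount-corner : ∀ i j → i ≤ m → j ≤ n → scaledCount i j (u i j) (v i j) ≡ target m n i j
  scaledCount-corner i j i≤m j≤n with ℕP.m≤n⇒m<n∨m≡n i≤m
  ... | inj₁ i<m rewrite <⇒≡ᵇ-false i m i<m =
    trans (cong (λ z → m!n! * ℕtoℚ z) (count-cornerˣ i j i<m)) (ℚP.*-zeroʳ m!n!)
  ... | inj₂ refl with ℕP.m≤n⇒m<n∨m≡n j≤n
  ...   | inj₁ j<n rewrite ≡ᵇ-refl m | <⇒≡ᵇ-false j n j<n =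
    trans (cong (λ z → m!n! * ℕtoℚ z) (count-cornerʸ j j<n)) (ℚP.*-zeroʳ m!n!)
  ...   | inj₂ refl rewrite ≡ᵇ-refl m | ≡ᵇ-refl n =
    trans (cong (λ z → m!n! * ℕtoℚ z) (count-top (u m n) (v m n))) (ℚP.*-identityʳ m!n!)

  goncarov : Poly m n
  goncarov = newtonPoly m n (λ i j → scaledCount i j 0 0)

  goncarov-isDiffGoncarov : IsDiffGoncarov m n negUX negUY goncarov
  goncarov-isDiffGoncarov i j i≤m j≤n =
    trans (agree-from-origins (differences-recurrence goncarov) scaledCount-recurrence
             (λ i j → newtonPoly-ΔXY-0 m n (λ i j → scaledCount i j 0 0) i j)
             (u i j) (v i j) i j i≤m j≤n ℕP.≤-refl ℕP.≤-refl)
          (scaledCount-corner i j i≤m j≤n)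

  unionCount-eval : ∀ g → IsDiffGoncarov m n negUX negUY g →
                    ℕtoℚ (unionCount x y m n u v) * m!n! ≡ eval g 0ℚ 0ℚ
  unionCount-eval g g-isDiffGoncarov = begin
    ℕtoℚ (unionCount x y m n u v) * m!n!   ≡⟨ cong (λ z → ℕtoℚ z * m!n!) unionCount≡count ⟩
    ℕtoℚ (count 0 0 0 0) * m!n!            ≡⟨ ℚP.*-comm (ℕtoℚ (count 0 0 0 0)) m!n! ⟩
    scaledCount 0 0 0 0                    ≡⟨ agree-from-corners (differences-recurrence g) scaledCount-recurrence
                                                (λ i j i≤m j≤n → trans (g-isDiffGoncarov i j i≤m j≤n)
                                                                       (sym (scaledCount-corner i j i≤m j≤n)))
                                                0 0 0 0 z≤n z≤n z≤n z≤n ⟨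
    eval g 0ℚ 0ℚ                           ∎
    where open ≡-Reasoning

open import Data.Nat using (_∸_; _!; _*_)
open import Data.Rational using (ℚ; 0ℚ; -_)
open import Data.Product using (Σ; _×_; _,_)
open import Relation.Binary.PropositionalEquality using (_≡_)

corollary12 :
    (x y m n : ℕ) → 0 < x → 0 < y →
    (xz yz : ℕ → ℕ → ℕ) →
    (∀ i j → i ≤ m → j ≤ n → xz i j < x) →
    (∀ i j → i ≤ m → j ≤ n → yz i j < y) →
    (∀ i j i′ j′ → i′ ≤ i → j′ ≤ j → i ≤ m → j ≤ n → xz i j ≤ xz i′ j′) →
    (∀ i j i′ j′ → i′ ≤ i → j′ ≤ j → i ≤ m → j ≤ n → yz i j ≤ yz i′ j′) →
    let u : ℕ → ℕ → ℕ
        u i j = x ∸ xz i j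
        v : ℕ → ℕ → ℕ
        v i j = y ∸ yz i j
        negUX : ℕ → ℕ → ℚ
        negUX i j = - ℕtoℚ (u i j)
        negUY : ℕ → ℕ → ℚ
        negUY i j = - ℕtoℚ (v i j)
    in Σ (Poly m n) (IsDiffGoncarov m n negUX negUY)
       × (∀ (g : Poly m n) → IsDiffGoncarov m n negUX negUY g →
            ℕtoℚ (unionCount x y m n u v) Data.Rational.* ℕtoℚ (m ! * n !) ≡ eval g 0ℚ 0ℚ)
corollary12 x y m n _ _ xz yz _ _ xz-antitone yz-antitone =
  (goncarov , goncarov-isDiffGoncarov) , unionCount-eval
  where open Corollary x y m n xz yz xz-antitone yz-antitone
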